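{- For every $n\ge 5$ and every integer $l$ with $TCL(G_n)\le l\le TCL(S_n)$, there exists a maximal outerplanar graph of order $n$ with total chord length equal to $l$.
   Context: A maximal outerplanar graph of order $n$ is regarded as a drawing consisting of an $n$-cycle $\mathcal{C}$ together with a triangulation (by non-crossing edges between vertices of $\mathcal{C}$) of the bounded region determined by $\mathcal{C}$. Edges not in $\mathcal{C}$ are chords; the length of a chord is the length of a shortest path in $\mathcal{C}$ between its endpoints; $TCL$ is the sum of the lengths of all chords. The shell graph $S_n$ is obtained from the $n$-cycle with vertices $v_1,\dots,v_n$ in clockwise order by adding the chords $v_1v_3,\dots,v_1v_{n-2}$; its total chord length is $\frac{n^2-9}{4}$ for $n$ odd and $\frac{n^2-8}{4}$ for $n$ even. The greedy graph $G_n$ is constructed as follows: label the vertices of $\mathcal{C}$ as $v_1,\dots,v_n$ clockwise; add a shortest possible chord starting at $v_1$ with final endpoint clockwise after $v_1$; then repeatedly take the final endpoint of the previously added chord as the starting endpoint of a new shortest possible chord whose final endpoint is clockwise from its starting endpoint, until $n-3$ chords have been added ("possible" meaning drawn inside the bounded region, not already an edge, and not crossing previously added chords). Its total chord length is $n(k+2)-3\cdot 2^{k+1}$ when $3\cdot 2^k\le n\le 3\cdot 2^{k+1}$. -}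

module Defs where

open import Data.Nat using (ℕ; zero; suc; _+_; _∸_; _<_; _⊓_; _<ᵇ_; _≡ᵇ_)
open import Data.Nat.ListAction using (sum)
open import Data.Bool.ListAction using (any)
open import Data.Bool using (Bool; true; false; if_then_else_; _∧_; _∨_; not)
open import Data.List using (List; []; _∷_; map; foldl; applyUpTo)
open import Data.Maybe using (Maybe; just; nothing)
open import Data.Product using (_×_; _,_; ∃-syntax)
open import Data.Sum using (_⊎_)
open import Data.List.Relation.Unary.All using (All)
open import Data.List.Relation.Unary.Unique.Propositional using (Unique)
open import Data.List.Membership.Propositional using (_∈_; _∉_)
open import Relation.Binary.PropositionalEquality using (_≡_)
open import Relation.Nullary using (¬_)

-- Vertices of the n-cycle C are 0,1,…,n-1 (vertex i is v_{i+1}), in clockwise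
-- order; the edges of C are {i, i+1} and {0, n-1}.
-- A chord is stored in normal form (i , j) with i < j.
Chord : Set
Chord = ℕ × ℕ

IsChord : ℕ → Chord → Set
IsChord n (i , j) = suc i < j × j < n × ¬ (i ≡ 0 × suc j ≡ n)

-- Two chords cross (interiors intersect) iff their endpoints interleave.
Cross : Chord → Chord → Set
Cross (a , b) (c , d) = (a < c × c < b × b < d) ⊎ (c < a × a < d × d < b)

-- A maximal outerplanar graph of order n, as a drawing: the n-cycle together
-- with a triangulation of its interior, i.e. a maximal set of pairwise
-- non-crossing chords (listed without repetition).
record IsMOP (n : ℕ) (cs : List Chord) : Set where
  field
    chords      : All (IsChord n) cs
    distinct    : Unique cs
    noncrossing : ∀ {c d} → c ∈ cs → d ∈ cs → ¬ Cross c d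
    maximal     : ∀ c → IsChord n c → c ∉ cs → ∃[ d ] (d ∈ cs × Cross c d)

-- length of a chord = length of a shortest path in C between its endpoints
chordLength : ℕ → Chord → ℕ
chordLength n (i , j) = (j ∸ i) ⊓ (n ∸ (j ∸ i))

TCL : ℕ → List Chord → ℕ
TCL n cs = sum (map (chordLength n) cs)

-- Shell graph S_n: chords v_1 v_3, …, v_1 v_{n-1}, i.e. (0 , k) for k = 2 … n-2.
shellChords : ℕ → List Chord
shellChords n = applyUpTo (λ k → 0 , 2 + k) (n ∸ 3)

normChord : ℕ → ℕ → Chord
normChord s t = if s <ᵇ t then (s , t) else (t , s)

eqChordᵇ : Chord → Chord → Bool
eqChordᵇ (a , b) (c , d) = (a ≡ᵇ c) ∧ (b ≡ᵇ d)

crossᵇ : Chord → Chord → Bool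
crossᵇ (a , b) (c , d) =
  ((a <ᵇ c) ∧ (c <ᵇ b) ∧ (b <ᵇ d)) ∨ ((c <ᵇ a) ∧ (a <ᵇ d) ∧ (d <ᵇ b))

addableᵇ : List Chord → Chord → Bool
addableᵇ cs c = not (any (eqChordᵇ c) cs) ∧ not (any (crossᵇ c) cs)

clockwise : ℕ → ℕ → ℕ → ℕ
clockwise n s d = if (s + d) <ᵇ n then s + d else (s + d) ∸ n

-- Among the chords from s to s + d (clockwise), d = 2 … n-2, that can be
-- added, choose one of minimum length (ties: smallest clockwise distance d).
-- Returns the chord and its final endpoint.
bestChord : ℕ → List Chord → ℕ → Maybe (Chord × ℕ)
bestChord n cs s = foldl step nothing (applyUpTo (2 +_) (n ∸ 3))
  where
  step : Maybe (Chord × ℕ) → ℕ → Maybe (Chord × ℕ)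
  step acc d with clockwise n s d
  ... | t with normChord s t
  ...   | c with addableᵇ cs c | acc
  ...     | false | _ = acc
  ...     | true  | nothing = just (c , t)
  ...     | true  | just (c′ , t′) =
          if chordLength n c <ᵇ chordLength n c′ then just (c , t) else acc

-- add chords starting from s, each new chord starting at the final endpoint
-- of the previous one (fuel = number of chords still to add)
greedyGo : ℕ → ℕ → ℕ → List Chord → List Chord
greedyGo n zero    s cs = cs
greedyGo n (suc k) s cs with bestChord n cs s
... | nothing      = cs
... | just (c , t) = greedyGo n k t (c ∷ cs)

greedyChords : ℕ → List Chord
greedyChords n = greedyGo n (n ∸ 3) 0 []

{-# OPTIONS --safe #-}

-- A maximal outerplanar graph of order n is a binary tree with n - 1 leaves (the edges of C other
-- than a root edge).  Pick a triangle of it whose three sides cut off polygons with a, b and c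
-- edges of C, a + b + c = n.  When a, b, c ≤ n / 2, no chord goes more than half way round C, so
-- the length of a chord is the number of edges of C it cuts off, and TCL is the sum of the linear
-- costs (external path lengths) of the three subtrees.
--
-- G_n is of this form: from the current vertex, the arcs cut off so far are sorted by size, and
-- the greedy chord always closes off the first two of them.  Starting there, TCL can be raised by
-- one at a time: a subtree below the largest linear cost for its size (that of a comb) can be
-- modified to have linear cost one more; when all three subtrees are combs, moving a leaf from the
-- smallest to the middle one does it, unless the smallest side is an edge of C: then the graph is S_n.

module Submission where

open import Defs
open import Data.Nat
open import Data.Nat.Properties
open import Data.Nat.DivMod
open import Data.Nat.ListAction using (sum)
open import Data.Nat.ListAction.Properties using (sum-++)
open import Data.Nat.Solver using (module +-*-Solver)
open import Data.Bool using (true; false; T; _∧_)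
open import Data.Bool.Properties using (T-∧; T-∨; T-≡; ∧-zeroʳ)
open import Data.Bool.ListAction using (any)
open import Data.List using (List; []; _∷_; _++_; _∷ʳ_; map; foldl; applyUpTo; length; replicate)
open import Data.List.Properties using (map-++; map-applyUpTo; applyUpTo-∷ʳ; length-++; length-map; map-replicate; length-replicate)
open import Data.List.Relation.Unary.All as All using (All; []; _∷_)
open import Data.List.Relation.Unary.All.Properties using (++⁺; replicate⁺; All¬⇒¬Any)
open import Data.List.Relation.Unary.Any as Any using (Any; here; there)
open import Data.List.Relation.Unary.Any.Properties using (any⁺; any⁻; Any-⊎⁻)
open import Data.List.Relation.Unary.AllPairs as AllPairs using (AllPairs; []; _∷_)
import Data.List.Relation.Unary.AllPairs.Properties as AllPairsₚ
open import Data.List.Relation.Unary.Unique.Propositional using (Unique)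
import Data.List.Relation.Unary.Unique.Propositional.Properties as Unique
open import Data.List.Membership.Propositional using (_∈_; _∉_)
open import Data.List.Membership.Propositional.Properties using (∈-++⁻; ∈-++⁺ˡ; ∈-++⁺ʳ)
open import Data.Maybe using (Maybe; just; nothing)
open import Data.Product using (Σ; _×_; _,_; proj₁; proj₂; ∃-syntax)
open import Data.Sum as Sum using (_⊎_; inj₁; inj₂)
open import Data.Unit using (⊤; tt)
open import Data.Empty using (⊥; ⊥-elim)
open import Function using (id; _∘_; _⇔_; mk⇔; Equivalence)
open import Function.Construct.Composition using (_⇔-∘_)
open import Relation.Nullary using (¬_; yes; no; contradiction; ofʸ; ofⁿ)
open import Relation.Binary.Definitions using (tri<; tri≈; tri>)
open import Relation.Binary.PropositionalEquality
open import Algebra.Properties.CommutativeSemigroup +-commutativeSemigroup using (xy∙z≈yx∙z; xy∙z≈xz∙y)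

open +-*-Solver using (solve; _:+_; _:=_; con)

-- A tree t encodes a triangulation of the polygon on the vertices i, i + 1, …, i + size t:
-- a leaf is a side (j , j + 1), and a node is the triangle on its base chord (i , i + size t)
-- together with the triangulations of the two polygons cut off by the other two sides.
data Tree : Set where
  leaf : Tree
  node : Tree → Tree → Tree

size : Tree → ℕ
size leaf       = 1
size (node l r) = size l + size r

1≤size : ∀ t → 1 ≤ size t
1≤size leaf       = ≤-refl
1≤size (node l r) = ≤-trans (1≤size l) (m≤m+n _ _)

chordsFrom : Tree → ℕ → List Chord
chordsFrom leaf       i = []
chordsFrom (node l r) i = (i , i + size (node l r)) ∷ chordsFrom l i ++ chordsFrom r (i + size l)

-- The maximal outerplanar graph of order size t + 1 whose cycle edge (0 , size t) is the root of t.
triangulation : Tree → List Chord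
triangulation leaf       = []
triangulation (node l r) = chordsFrom l 0 ++ chordsFrom r (size l)

Within : ℕ → ℕ → Chord → Set
Within lo hi (a , b) = lo ≤ a × 2 + a ≤ b × b ≤ hi

Within-weaken : ∀ {lo lo′ hi hi′} → lo′ ≤ lo → hi ≤ hi′ → ∀ {c} → Within lo hi c → Within lo′ hi′ c
Within-weaken lo′≤lo hi≤hi′ {a , b} (lo≤a , a+2≤b , b≤hi) =
  ≤-trans lo′≤lo lo≤a , a+2≤b , ≤-trans b≤hi hi≤hi′

chordsFrom-within : ∀ t i → All (Within i (i + size t)) (chordsFrom t i)
chordsFrom-within leaf       i = []
chordsFrom-within (node l r) i =
  (≤-refl , ≤-trans (≤-reflexive (+-comm 2 i)) (+-monoʳ-≤ i (+-mono-≤ (1≤size l) (1≤size r))) , ≤-refl) ∷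
  ++⁺ (All.map (Within-weaken ≤-refl (+-monoʳ-≤ i (m≤m+n _ _))) (chordsFrom-within l i))
      (All.map (Within-weaken (m≤m+n i _) (≤-reflexive (+-assoc i _ _))) (chordsFrom-within r (i + size l)))

Cross-sym : ∀ {c d} → Cross c d → Cross d c
Cross-sym {a , b} {c , d} (inj₁ crossing) = inj₂ crossing
Cross-sym {a , b} {c , d} (inj₂ crossing) = inj₁ crossing

Cross-irrefl : ∀ {c} → ¬ Cross c c
Cross-irrefl (inj₁ (a<a , _)) = <-irrefl refl a<a
Cross-irrefl (inj₂ (a<a , _)) = <-irrefl refl a<a

¬Cross-disjoint : ∀ {a b c d} → a < b → b ≤ c → ¬ Cross (a , b) (c , d)
¬Cross-disjoint a<b b≤c (inj₁ (_ , c<b , _)) = <⇒≱ c<b b≤c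
¬Cross-disjoint a<b b≤c (inj₂ (c<a , _ , _)) = <⇒≱ (<-trans c<a a<b) b≤c

¬Cross-nested : ∀ {i j c d} → i ≤ c → d ≤ j → ¬ Cross (i , j) (c , d)
¬Cross-nested i≤c d≤j (inj₁ (_ , _ , j<d)) = <⇒≱ j<d d≤j
¬Cross-nested i≤c d≤j (inj₂ (c<i , _ , _)) = <⇒≱ c<i i≤c

NonCrossing : List Chord → Set
NonCrossing xs = ∀ {c d} → c ∈ xs → d ∈ xs → ¬ Cross c d

NonCrossing-∷ : ∀ {c xs} → All (λ d → ¬ Cross c d) xs → NonCrossing xs → NonCrossing (c ∷ xs)
NonCrossing-∷ c∦xs xs∦ (here refl) (here refl) = Cross-irrefl
NonCrossing-∷ c∦xs xs∦ (here refl) (there d∈) = All.lookup c∦xs d∈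
NonCrossing-∷ c∦xs xs∦ (there c∈) (here refl) = All.lookup c∦xs c∈ ∘ Cross-sym
NonCrossing-∷ c∦xs xs∦ (there c∈) (there d∈) = xs∦ c∈ d∈

NonCrossing-++ : ∀ {xs ys} → NonCrossing xs → NonCrossing ys →
                 (∀ {c d} → c ∈ xs → d ∈ ys → ¬ Cross c d) → NonCrossing (xs ++ ys)
NonCrossing-++ {xs} xs∦ ys∦ xs∦ys c∈ d∈ with ∈-++⁻ xs c∈ | ∈-++⁻ xs d∈
... | inj₁ c∈xs | inj₁ d∈xs = xs∦ c∈xs d∈xs
... | inj₁ c∈xs | inj₂ d∈ys = xs∦ys c∈xs d∈ys
... | inj₂ c∈ys | inj₁ d∈xs = xs∦ys d∈xs c∈ys ∘ Cross-sym
... | inj₂ c∈ys | inj₂ d∈ys = ys∦ c∈ys d∈ys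

module _ (l r : Tree) (i : ℕ) where
  private
    m = i + size l

  chordsFrom-left : ∀ {a b} → (a , b) ∈ chordsFrom l i → suc a < b × b ≤ m
  chordsFrom-left c∈ with All.lookup (chordsFrom-within l i) c∈
  ... | (_ , a+2≤b , b≤m) = a+2≤b , b≤m

  chordsFrom-right : ∀ {a b} → (a , b) ∈ chordsFrom r m → m ≤ a
  chordsFrom-right c∈ = proj₁ (All.lookup (chordsFrom-within r m) c∈)

  chordsFrom-separated : ∀ {c d} → c ∈ chordsFrom l i → d ∈ chordsFrom r m → ¬ Cross c d
  chordsFrom-separated c∈ d∈ with chordsFrom-left c∈
  ... | a+1<b , b≤m = ¬Cross-disjoint (<-trans (n<1+n _) a+1<b) (≤-trans b≤m (chordsFrom-right d∈))

  chordsFrom-disjoint : ∀ {c} → ¬ (c ∈ chordsFrom l i × c ∈ chordsFrom r m)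
  chordsFrom-disjoint (c∈l , c∈r) with chordsFrom-left c∈l
  ... | a+1<b , b≤m = <⇒≱ (<-trans (n<1+n _) a+1<b) (≤-trans b≤m (chordsFrom-right c∈r))

  base∉chordsFrom : (i , i + size (node l r)) ∉ chordsFrom l i ++ chordsFrom r m
  base∉chordsFrom root∈ with ∈-++⁻ (chordsFrom l i) root∈
  ... | inj₁ root∈l = <⇒≱ (+-monoʳ-< i (m<m+n (size l) (1≤size r))) (proj₂ (chordsFrom-left root∈l))
  ... | inj₂ root∈r = <⇒≱ (m<m+n i (1≤size l)) (chordsFrom-right root∈r)

chordsFrom-nonCrossing : ∀ t i → NonCrossing (chordsFrom t i)
chordsFrom-nonCrossing leaf       i ()
chordsFrom-nonCrossing (node l r) i =
  NonCrossing-∷ (All.map (λ { {c , d} (i≤c , _ , d≤j) → ¬Cross-nested i≤c d≤j }) (All.tail (chordsFrom-within (node l r) i)))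
    (NonCrossing-++ (chordsFrom-nonCrossing l i) (chordsFrom-nonCrossing r (i + size l)) (chordsFrom-separated l r i))

chordsFrom-unique : ∀ t i → Unique (chordsFrom t i)
chordsFrom-unique leaf       i = []
chordsFrom-unique (node l r) i =
  All.tabulate (λ c∈ root≡c → base∉chordsFrom l r i (subst (_∈ _) (sym root≡c) c∈)) ∷
  Unique.++⁺ (chordsFrom-unique l i) (chordsFrom-unique r (i + size l)) (chordsFrom-disjoint l r i)

base∈chordsFrom : ∀ t i → 2 ≤ size t → (i , i + size t) ∈ chordsFrom t i
base∈chordsFrom leaf       i (s≤s ())
base∈chordsFrom (node l r) i _ = here refl

2≤gap : ∀ {i a k} → i < a → a < i + k → 2 ≤ k
2≤gap {i} i<a a<i+k = +-cancelˡ-≤ i 2 _ (≤-trans (≤-reflexive (+-comm i 2)) (≤-trans (s≤s i<a) a<i+k))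

chordsFrom-maximal : ∀ t i {c} → Within i (i + size t) c → c ∉ chordsFrom t i →
                     ∃[ d ] (d ∈ chordsFrom t i × Cross c d)
chordsFrom-maximal leaf i (i≤a , a+2≤b , b≤i+1) _ =
  ⊥-elim (<⇒≱ (≤-trans (s≤s (s≤s i≤a)) a+2≤b) (≤-trans b≤i+1 (≤-reflexive (+-comm i 1))))
chordsFrom-maximal (node l r) i {a , b} (i≤a , a+2≤b , b≤j) c∉ with b ≤? i + size l | i + size l ≤? a
... | yes b≤m | _ =
  let d , d∈ , cross = chordsFrom-maximal l i (i≤a , a+2≤b , b≤m) (λ c∈ → c∉ (there (∈-++⁺ˡ c∈)))
  in d , there (∈-++⁺ˡ d∈) , cross
... | no _ | yes m≤a =
  let d , d∈ , cross = chordsFrom-maximal r (i + size l) (m≤a , a+2≤b , ≤-trans b≤j (≤-reflexive (sym (+-assoc i _ _))))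
                                          (λ c∈ → c∉ (there (∈-++⁺ʳ _ c∈)))
  in d , there (∈-++⁺ʳ _ d∈) , cross
... | no b≰m | no m≰a with i <? a
...   | yes i<a = (i , i + size l) , there (∈-++⁺ˡ (base∈chordsFrom l i (2≤gap i<a (≰⇒> m≰a)))) ,
                  inj₂ (i<a , ≰⇒> m≰a , ≰⇒> b≰m)
...   | no i≮a = (i + size l , i + size l + size r) , there (∈-++⁺ʳ _ (base∈chordsFrom r _ (2≤gap m<b b<m+r))) ,
                  inj₁ (≰⇒> m≰a , m<b , b<m+r)
  where
  m<b = ≰⇒> b≰m
  b<m+r : b < i + size l + size r
  b<m+r = ≤∧≢⇒< (≤-trans b≤j (≤-reflexive (sym (+-assoc i _ _))))
                 (λ b≡ → c∉ (here (cong₂ _,_ (≤-antisym (≮⇒≥ i≮a) i≤a) (trans b≡ (+-assoc i _ _)))))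

module _ (l r : Tree) where
  private
    t = node l r
    k = size t

  IsChord⇒Within : ∀ {c} → IsChord (suc k) c → Within 0 k c
  IsChord⇒Within {a , b} (a+1<b , b<n , _) = z≤n , a+1<b , ≤-pred b<n

  Within⇒IsChord : ∀ {c} → Within 0 k c → (0 , k) ≢ c → IsChord (suc k) c
  Within⇒IsChord {a , b} (_ , a+2≤b , b≤k) root≢c = a+2≤b , s≤s b≤k ,
    λ { (refl , refl) → root≢c refl }

  node-isMOP : IsMOP (suc k) (triangulation t)
  node-isMOP = record
    { chords      = All.zipWith (λ (within , ne) → Within⇒IsChord within ne)
                                (All.tail (chordsFrom-within t 0) , AllPairs.head (chordsFrom-unique t 0))
    ; distinct    = AllPairs.tail (chordsFrom-unique t 0)
    ; noncrossing = λ c∈ d∈ → chordsFrom-nonCrossing t 0 (there c∈) (there d∈)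
    ; maximal     = maximal
    }
    where
    maximal : ∀ c → IsChord (suc k) c → c ∉ triangulation t → ∃[ d ] (d ∈ triangulation t × Cross c d)
    maximal c c-chord c∉ = notRoot (chordsFrom-maximal t 0 c-within ∉chordsFrom)
      where
      c-within = IsChord⇒Within c-chord
      ∉chordsFrom : c ∉ chordsFrom t 0
      ∉chordsFrom (here refl) = proj₂ (proj₂ c-chord) (refl , refl)
      ∉chordsFrom (there c∈) = c∉ c∈
      notRoot : ∃[ d ] (d ∈ chordsFrom t 0 × Cross c d) → ∃[ d ] (d ∈ triangulation t × Cross c d)
      notRoot (d , here refl , cross) = ⊥-elim (¬Cross-nested z≤n (proj₂ (proj₂ c-within)) (Cross-sym cross))
      notRoot (d , there d∈ , cross) = d , d∈ , cross

triangulation-isMOP : ∀ t → IsMOP (suc (size t)) (triangulation t)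
triangulation-isMOP (node l r) = node-isMOP l r
triangulation-isMOP leaf       = record
  { chords      = []
  ; distinct    = []
  ; noncrossing = λ ()
  ; maximal     = λ { (a , b) (a+1<b , b<2 , _) _ → ⊥-elim (<⇒≱ (≤-trans (s≤s (s≤s z≤n)) a+1<b) (≤-pred b<2)) }
  }

cycDist : ℕ → ℕ → ℕ
cycDist n d = d ⊓ (n ∸ d)

cycDist-complement : ∀ {n x y} → x + y ≡ n → cycDist n x ≡ cycDist n y
cycDist-complement {x = x} {y} refl = begin
  x ⊓ (x + y ∸ x)   ≡⟨ cong₂ _⊓_ (sym (m+n∸n≡m x y)) (m+n∸m≡n x y) ⟩
  (x + y ∸ y) ⊓ y   ≡⟨ ⊓-comm _ y ⟩
  y ⊓ (x + y ∸ y)   ∎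
  where open ≡-Reasoning

cycDist-short : ∀ {n d} → d + d ≤ n → cycDist n d ≡ d
cycDist-short {n} {d} 2d≤n = m≤n⇒m⊓n≡m (≤-trans (≤-reflexive (sym (m+n∸n≡m d d))) (∸-monoˡ-≤ d 2d≤n))

cost : ℕ → Tree → ℕ
cost n leaf       = 0
cost n (node l r) = cycDist n (size l + size r) + cost n l + cost n r

innerCost : ℕ → Tree → ℕ
innerCost n leaf       = 0
innerCost n (node l r) = cost n l + cost n r

TCL-++ : ∀ n xs ys → TCL n (xs ++ ys) ≡ TCL n xs + TCL n ys
TCL-++ n xs ys = trans (cong sum (map-++ (chordLength n) xs ys)) (sum-++ (map (chordLength n) xs) _)

TCL-chordsFrom : ∀ n t i → TCL n (chordsFrom t i) ≡ cost n t
TCL-chordsFrom n leaf       i = refl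
TCL-chordsFrom n (node l r) i = begin
  cycDist n (i + (size l + size r) ∸ i) + TCL n (chordsFrom l i ++ chordsFrom r (i + size l))
    ≡⟨ cong₂ _+_ (cong (cycDist n) (m+n∸m≡n i _)) (TCL-++ n (chordsFrom l i) _) ⟩
  cycDist n (size l + size r) + (TCL n (chordsFrom l i) + TCL n (chordsFrom r (i + size l)))
    ≡⟨ cong (λ x → cycDist n (size l + size r) + x) (cong₂ _+_ (TCL-chordsFrom n l i) (TCL-chordsFrom n r _)) ⟩
  cycDist n (size l + size r) + (cost n l + cost n r)
    ≡⟨ +-assoc _ (cost n l) (cost n r) ⟨
  cost n (node l r) ∎
  where open ≡-Reasoning

TCL-triangulation : ∀ n t → TCL n (triangulation t) ≡ innerCost n t
TCL-triangulation n leaf       = refl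
TCL-triangulation n (node l r) =
  trans (TCL-++ n (chordsFrom l 0) _) (cong₂ _+_ (TCL-chordsFrom n l 0) (TCL-chordsFrom n r _))

-- Glues x to the base of t and re-hangs the result from the last boundary edge of t.
reroot : Tree → Tree → Tree
reroot leaf       x = x
reroot (node l r) x = reroot r (node x l)

size-reroot : ∀ t x → size (reroot t x) + 1 ≡ size t + size x
size-reroot leaf       x = +-comm (size x) 1
size-reroot (node l r) x = begin
  size (reroot r (node x l)) + 1   ≡⟨ size-reroot r (node x l) ⟩
  size r + (size x + size l)       ≡⟨ solve 3 (λ x l r → r :+ (x :+ l) := (l :+ r) :+ x) refl (size x) (size l) (size r) ⟩
  size l + size r + size x         ∎
  where open ≡-Reasoning

innerCost-reroot : ∀ n t x y → size t + size (node x y) ≡ n →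
                   innerCost n (reroot t (node x y)) ≡ innerCost n (node x y) + cost n t
innerCost-reroot n leaf       x y _  = sym (+-identityʳ _)
innerCost-reroot n (node l r) x y sizes = begin
  innerCost n (reroot r (node (node x y) l))
    ≡⟨ innerCost-reroot n r (node x y) l sizes′ ⟩
  cycDist n (size x + size y) + cost n x + cost n y + cost n l + cost n r
    ≡⟨ cong (λ d → d + cost n x + cost n y + cost n l + cost n r) (cycDist-complement (trans (+-comm _ (size l + size r)) sizes)) ⟩
  cycDist n (size l + size r) + cost n x + cost n y + cost n l + cost n r
    ≡⟨ solve 5 (λ d a b c e → d :+ a :+ b :+ c :+ e := (a :+ b) :+ (d :+ c :+ e)) refl
               (cycDist n (size l + size r)) (cost n x) (cost n y) (cost n l) (cost n r) ⟩
  innerCost n (node x y) + cost n (node l r) ∎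
  where
  open ≡-Reasoning
  sizes′ : size r + (size x + size y + size l) ≡ n
  sizes′ = trans (solve 4 (λ r x y l → r :+ (x :+ y :+ l) := l :+ r :+ (x :+ y)) refl (size r) (size x) (size y) (size l)) sizes

-- The tree with a triangle whose sides cut off the polygons triangulated by a, b and c.
triangle : Tree → Tree → Tree → Tree
triangle a b c = reroot c (node a b)

size-triangle : ∀ a b c → suc (size (triangle a b c)) ≡ size a + size b + size c
size-triangle a b c = trans (+-comm 1 _) (trans (size-reroot c (node a b)) (+-comm (size c) _))

TCL-triangle : ∀ n a b c → size a + size b + size c ≡ n →
               TCL n (triangulation (triangle a b c)) ≡ cost n a + cost n b + cost n c
TCL-triangle n a b c sizes =
  trans (TCL-triangulation n (triangle a b c)) (innerCost-reroot n c a b (trans (+-comm (size c) _) sizes))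

linearCost : Tree → ℕ
linearCost leaf       = 0
linearCost (node l r) = size l + size r + linearCost l + linearCost r

cost-short : ∀ n t → size t + size t ≤ n → cost n t ≡ linearCost t
cost-short n leaf       _    = refl
cost-short n (node l r) 2t≤n = cong₂ _+_ (cong₂ _+_ (cycDist-short 2t≤n) (cost-short n l 2l≤n)) (cost-short n r 2r≤n)
  where
  2l≤n = ≤-trans (+-mono-≤ (m≤m+n (size l) (size r)) (m≤m+n (size l) (size r))) 2t≤n
  2r≤n = ≤-trans (+-mono-≤ (m≤n+m (size r) (size l)) (m≤n+m (size r) (size l))) 2t≤n

Balanced : ℕ → ℕ → ℕ → ℕ → Set
Balanced n a b c = a + b + c ≡ n × a + a ≤ n × b + b ≤ n × c + c ≤ n

-- A central triangle none of whose sides cuts off more than half of C; by cost-short the TCL of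
-- its triangulation is the value v.
record BalancedTriple (n v : ℕ) : Set where
  constructor triple
  field
    A B C    : Tree
    balanced : Balanced n (size A) (size B) (size C)
    value    : linearCost A + linearCost B + linearCost C ≡ v

BalancedTriple⇒MOP : ∀ {n l} → BalancedTriple n l → ∃[ cs ] (IsMOP n cs × TCL n cs ≡ l)
BalancedTriple⇒MOP {n} (triple A B C (sizes , 2a≤n , 2b≤n , 2c≤n) value) =
  triangulation (triangle A B C) ,
  subst (λ k → IsMOP k _) (trans (size-triangle A B C) sizes) (triangulation-isMOP (triangle A B C)) ,
  (begin
    TCL n (triangulation (triangle A B C))   ≡⟨ TCL-triangle n A B C sizes ⟩
    cost n A + cost n B + cost n C
      ≡⟨ cong₂ _+_ (cong₂ _+_ (cost-short n A 2a≤n) (cost-short n B 2b≤n)) (cost-short n C 2c≤n) ⟩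
    linearCost A + linearCost B + linearCost C ≡⟨ value ⟩
    _ ∎)
  where open ≡-Reasoning

-- 2 + 3 + ⋯ + k: the linear cost of a comb with k leaves, the largest possible (linearCost≤maxCost).
maxCost : ℕ → ℕ
maxCost 0             = 0
maxCost 1             = 0
maxCost (suc (suc k)) = maxCost (suc k) + suc (suc k)

maxCost-suc : ∀ {k} → 1 ≤ k → maxCost (suc k) ≡ maxCost k + suc k
maxCost-suc {suc k} _ = refl

maxCost-+1 : ∀ {x} → 1 ≤ x → x + 1 + maxCost x + maxCost 1 ≡ maxCost (x + 1)
maxCost-+1 {x} 1≤x = begin
  x + 1 + maxCost x + 0   ≡⟨ solve 2 (λ x m → x :+ con 1 :+ m :+ con 0 := m :+ (con 1 :+ x)) refl x (maxCost x) ⟩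
  maxCost x + suc x       ≡⟨ maxCost-suc 1≤x ⟨
  maxCost (suc x)         ≡⟨ cong maxCost (+-comm 1 x) ⟩
  maxCost (x + 1)         ∎
  where open ≡-Reasoning

maxCost-superadditive : ∀ x y → 1 ≤ x → 1 ≤ y → x + y + maxCost x + maxCost y ≤ maxCost (x + y)
maxCost-superadditive x (suc zero) 1≤x _ = ≤-reflexive (maxCost-+1 1≤x)
maxCost-superadditive x (suc (suc y)) 1≤x _ = begin
  x + suc (suc y) + maxCost x + (maxCost (suc y) + suc (suc y))
    ≡⟨ solve 4 (λ x y a b → x :+ (con 2 :+ y) :+ a :+ (b :+ (con 2 :+ y))
                         := (x :+ (con 1 :+ y) :+ a :+ b) :+ (con 1 :+ (con 2 :+ y))) refl x y (maxCost x) (maxCost (suc y)) ⟩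
  (x + suc y + maxCost x + maxCost (suc y)) + suc (suc (suc y))
    ≤⟨ +-mono-≤ (maxCost-superadditive x (suc y) 1≤x (s≤s z≤n)) (s≤s (+-monoˡ-≤ (suc y) 1≤x)) ⟩
  maxCost (x + suc y) + suc (x + suc y)
    ≡⟨ maxCost-suc (≤-trans 1≤x (m≤m+n x _)) ⟨
  maxCost (suc (x + suc y))
    ≡⟨ cong maxCost (+-suc x (suc y)) ⟨
  maxCost (x + suc (suc y)) ∎
  where open ≤-Reasoning

linearCost≤maxCost : ∀ t → linearCost t ≤ maxCost (size t)
linearCost≤maxCost leaf       = z≤n
linearCost≤maxCost (node l r) = begin
  size l + size r + linearCost l + linearCost r
    ≤⟨ +-mono-≤ (+-monoʳ-≤ (size l + size r) (linearCost≤maxCost l)) (linearCost≤maxCost r) ⟩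
  size l + size r + maxCost (size l) + maxCost (size r)
    ≤⟨ maxCost-superadditive (size l) (size r) (1≤size l) (1≤size r) ⟩
  maxCost (size l + size r) ∎
  where open ≤-Reasoning

-- comb k has k + 1 leaves at depths 1, 2, …, k, k.
comb : ℕ → Tree
comb zero    = leaf
comb (suc k) = node leaf (comb k)

size-comb : ∀ k → size (comb k) ≡ suc k
size-comb zero    = refl
size-comb (suc k) = cong suc (size-comb k)

linearCost-comb : ∀ k → linearCost (comb k) ≡ maxCost (suc k)
linearCost-comb zero    = refl
linearCost-comb (suc k) = begin
  suc (size (comb k) + 0 + linearCost (comb k))  ≡⟨ cong₂ (λ s c → suc (s + 0 + c)) (size-comb k) (linearCost-comb k) ⟩
  suc (suc k + 0 + maxCost (suc k))
    ≡⟨ solve 2 (λ k m → con 1 :+ (con 1 :+ k :+ con 0 :+ m) := m :+ (con 2 :+ k)) refl k (maxCost (suc k)) ⟩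
  maxCost (suc k) + suc (suc k)                  ∎
  where open ≡-Reasoning

-- sprout d k is comb (2 + d + k) with its leaf at depth d + 1 split into two.
sprout : ℕ → ℕ → Tree
sprout zero    k = node (node leaf leaf) (comb k)
sprout (suc d) k = node leaf (sprout d k)

size-sprout : ∀ d k → size (sprout d k) ≡ 3 + d + k
size-sprout zero    k = cong (2 +_) (size-comb k)
size-sprout (suc d) k = cong suc (size-sprout d k)

linearCost-sprout : ∀ d k → linearCost (sprout d k) ≡ maxCost (2 + d + k) + (3 + d)
linearCost-sprout zero    k = begin
  2 + size (comb k) + 2 + linearCost (comb k)
    ≡⟨ cong₂ (λ s c → 2 + s + 2 + c) (size-comb k) (linearCost-comb k) ⟩
  2 + suc k + 2 + maxCost (suc k)
    ≡⟨ solve 2 (λ k m → con 2 :+ (con 1 :+ k) :+ con 2 :+ m := m :+ (con 2 :+ k) :+ con 3) refl k (maxCost (suc k)) ⟩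
  maxCost (suc k) + (2 + k) + 3 ∎
  where open ≡-Reasoning
linearCost-sprout (suc d) k = begin
  suc (size (sprout d k) + 0 + linearCost (sprout d k))
    ≡⟨ cong₂ (λ s c → suc (s + 0 + c)) (size-sprout d k) (linearCost-sprout d k) ⟩
  suc (3 + d + k + 0 + (maxCost (2 + d + k) + (3 + d)))
    ≡⟨ solve 3 (λ d k m → con 1 :+ (con 3 :+ d :+ k :+ con 0 :+ (m :+ (con 3 :+ d)))
                        := m :+ (con 3 :+ d :+ k) :+ (con 4 :+ d)) refl d k (maxCost (2 + d + k)) ⟩
  maxCost (2 + d + k) + (3 + d + k) + (4 + d) ∎
  where open ≡-Reasoning

-- Moving a leaf from a comb with 2 + d leaves to depth d + 1 of a comb with 2 + d + k leaves.
moveLeaf : ∀ d k → linearCost (sprout d k) + linearCost (comb d) ≡ suc (maxCost (2 + d + k) + maxCost (2 + d))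
moveLeaf d k = begin
  linearCost (sprout d k) + linearCost (comb d)     ≡⟨ cong₂ _+_ (linearCost-sprout d k) (linearCost-comb d) ⟩
  maxCost (2 + d + k) + (3 + d) + maxCost (suc d)
    ≡⟨ solve 3 (λ a d b → a :+ (con 3 :+ d) :+ b := con 1 :+ (a :+ (b :+ (con 2 :+ d)))) refl
               (maxCost (2 + d + k)) d (maxCost (suc d)) ⟩
  suc (maxCost (2 + d + k) + maxCost (2 + d))       ∎
  where open ≡-Reasoning

-- x + y + maxCost x + maxCost y is the linear cost of a node with two combs of x and y leaves.
combPair-increment-≤ : ∀ x y → y ≤ x → 1 ≤ x → 1 ≤ y → x + y + maxCost x + maxCost y < maxCost (x + y) →
                       ∃[ t ] (size t ≡ x + y × linearCost t ≡ suc (x + y + maxCost x + maxCost y))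
combPair-increment-≤ x (suc zero)    _   1≤x _ notMax = ⊥-elim (<-irrefl (maxCost-+1 1≤x) notMax)
combPair-increment-≤ x (suc (suc d)) y≤x _   _ _ with m≤n⇒∃[o]m+o≡n y≤x
... | k , refl = node (sprout d k) (comb d) ,
  trans (cong₂ _+_ (size-sprout d k) (size-comb d)) (sym (+-suc (2 + d + k) (suc d))) ,
  (begin
    size (sprout d k) + size (comb d) + linearCost (sprout d k) + linearCost (comb d)
      ≡⟨ +-assoc (size (sprout d k) + size (comb d)) _ _ ⟩
    size (sprout d k) + size (comb d) + (linearCost (sprout d k) + linearCost (comb d))
      ≡⟨ cong₂ _+_ (trans (cong₂ _+_ (size-sprout d k) (size-comb d)) (sym (+-suc (2 + d + k) (suc d)))) (moveLeaf d k) ⟩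
    2 + d + k + (2 + d) + suc (maxCost (2 + d + k) + maxCost (2 + d))
      ≡⟨ solve 3 (λ s a b → s :+ (con 1 :+ (a :+ b)) := con 1 :+ (s :+ a :+ b)) refl
                 (2 + d + k + (2 + d)) (maxCost (2 + d + k)) (maxCost (2 + d)) ⟩
    suc (2 + d + k + (2 + d) + maxCost (2 + d + k) + maxCost (2 + d)) ∎)
  where open ≡-Reasoning

combPair-comm : ∀ x y → y + x + maxCost y + maxCost x ≡ x + y + maxCost x + maxCost y
combPair-comm x y = solve 4 (λ x y a b → y :+ x :+ b :+ a := x :+ y :+ a :+ b) refl x y (maxCost x) (maxCost y)

combPair-increment : ∀ x y → 1 ≤ x → 1 ≤ y → x + y + maxCost x + maxCost y < maxCost (x + y) →
                     ∃[ t ] (size t ≡ x + y × linearCost t ≡ suc (x + y + maxCost x + maxCost y))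
combPair-increment x y 1≤x 1≤y notMax with ≤-total y x
... | inj₁ y≤x = combPair-increment-≤ x y y≤x 1≤x 1≤y notMax
... | inj₂ x≤y with combPair-increment-≤ y x x≤y 1≤y 1≤x (subst₂ _<_ (combPair-comm y x) (cong maxCost (+-comm x y)) notMax)
...   | t , size≡ , cost≡ = t , trans size≡ (+-comm y x) , trans cost≡ (cong suc (combPair-comm x y))

linearCost-maximal : ∀ t → ¬ linearCost t < maxCost (size t) → linearCost t ≡ maxCost (size t)
linearCost-maximal t notLess = ≤-antisym (linearCost≤maxCost t) (≮⇒≥ notLess)

linearCost-increment : ∀ t → linearCost t < maxCost (size t) →
                       ∃[ t′ ] (size t′ ≡ size t × linearCost t′ ≡ suc (linearCost t))
linearCost-increment leaf       ()
linearCost-increment (node l r) notMax with linearCost l <? maxCost (size l) | linearCost r <? maxCost (size r)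
... | yes l-notMax | _ with linearCost-increment l l-notMax
...   | l′ , size≡ , cost≡ = node l′ r , cong (_+ size r) size≡ ,
  trans (cong₂ (λ s c → s + size r + c + linearCost r) size≡ cost≡) (cong (_+ linearCost r) (+-suc (size l + size r) _))
linearCost-increment (node l r) notMax | no _ | yes r-notMax with linearCost-increment r r-notMax
...   | r′ , size≡ , cost≡ = node l r′ , cong (size l +_) size≡ ,
  trans (cong₂ (λ s c → size l + s + linearCost l + c) size≡ cost≡) (+-suc (size l + size r + linearCost l) _)
linearCost-increment (node l r) notMax | no l-max | no r-max =
  let t , size≡ , cost≡ = combPair-increment (size l) (size r) (1≤size l) (1≤size r)
                                             (subst (_< maxCost (size l + size r)) maximal notMax)
  in  t , size≡ , trans cost≡ (cong suc (sym maximal))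
  where
  maximal : linearCost (node l r) ≡ size l + size r + maxCost (size l) + maxCost (size r)
  maximal = cong₂ (λ a b → size l + size r + a + b) (linearCost-maximal l l-max) (linearCost-maximal r r-max)

sum-applyUpTo-+ : ∀ (f : ℕ → ℕ) a b → sum (applyUpTo f (a + b)) ≡ sum (applyUpTo f a) + sum (applyUpTo (λ i → f (a + i)) b)
sum-applyUpTo-+ f zero    b = refl
sum-applyUpTo-+ f (suc a) b = trans (cong (f 0 +_) (sum-applyUpTo-+ (λ i → f (suc i)) a b)) (sym (+-assoc (f 0) _ _))

sum-applyUpTo-cong : ∀ {f g : ℕ → ℕ} m → (∀ i → i < m → f i ≡ g i) → sum (applyUpTo f m) ≡ sum (applyUpTo g m)
sum-applyUpTo-cong zero    f≗g = refl
sum-applyUpTo-cong (suc m) f≗g = cong₂ _+_ (f≗g 0 z<s) (sum-applyUpTo-cong m (λ i i<m → f≗g (suc i) (s<s i<m)))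

sum-ascending : ∀ m → sum (applyUpTo (2 +_) m) ≡ maxCost (suc m)
sum-ascending zero    = refl
sum-ascending (suc m) = begin
  sum (applyUpTo (2 +_) (suc m))            ≡⟨ cong sum (applyUpTo-∷ʳ (2 +_) m) ⟨
  sum (applyUpTo (2 +_) m ∷ʳ (2 + m))       ≡⟨ sum-++ (applyUpTo (2 +_) m) _ ⟩
  sum (applyUpTo (2 +_) m) + (2 + m + 0)    ≡⟨ cong₂ _+_ (sum-ascending m) (+-identityʳ _) ⟩
  maxCost (suc m) + suc (suc m)             ∎
  where open ≡-Reasoning

sum-descending : ∀ y → sum (applyUpTo (λ i → suc y ∸ i) y) ≡ maxCost (suc y)
sum-descending zero    = refl
sum-descending (suc y) = trans (cong (2 + y +_) (sum-descending y)) (+-comm (2 + y) _)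

TCL-shell : ∀ {n x y} → x + y + 1 ≡ n → x + x ≤ n → y + y ≤ n → 1 ≤ x → 1 ≤ y →
            TCL n (shellChords n) ≡ maxCost x + maxCost y
TCL-shell {n} {suc x} {suc y} sizes 2x≤n 2y≤n _ _ = begin
  sum (map (chordLength n) (applyUpTo (λ k → 0 , 2 + k) (n ∸ 3)))
    ≡⟨ cong sum (map-applyUpTo _ (chordLength n) (n ∸ 3)) ⟩
  sum (applyUpTo shellLength (n ∸ 3))
    ≡⟨ cong (λ m → sum (applyUpTo shellLength m)) n∸3≡x+y ⟩
  sum (applyUpTo shellLength (x + y))
    ≡⟨ sum-applyUpTo-+ shellLength x y ⟩
  sum (applyUpTo shellLength x) + sum (applyUpTo (λ i → shellLength (x + i)) y)
    ≡⟨ cong₂ _+_ (sum-applyUpTo-cong x ascending) (sum-applyUpTo-cong y descending) ⟩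
  sum (applyUpTo (2 +_) x) + sum (applyUpTo (λ i → suc y ∸ i) y)
    ≡⟨ cong₂ _+_ (sum-ascending x) (sum-descending y) ⟩
  maxCost (suc x) + maxCost (suc y) ∎
  where
  open ≡-Reasoning
  shellLength : ℕ → ℕ
  shellLength k = cycDist n (2 + k)
  n∸3≡x+y : n ∸ 3 ≡ x + y
  n∸3≡x+y = begin
    n ∸ 3                   ≡⟨ cong (_∸ 3) sizes ⟨
    suc x + suc y + 1 ∸ 3   ≡⟨ cong (_∸ 3) (solve 2 (λ x y → con 1 :+ x :+ (con 1 :+ y) :+ con 1
                                                        := x :+ y :+ con 3) refl x y) ⟩
    x + y + 3 ∸ 3           ≡⟨ m+n∸n≡m (x + y) 3 ⟩
    x + y                   ∎
  ascending : ∀ i → i < x → shellLength i ≡ 2 + i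
  ascending i i<x = cycDist-short (≤-trans (+-mono-≤ (s≤s i<x) (s≤s i<x)) 2x≤n)
  descending : ∀ i → i < y → shellLength (x + i) ≡ suc y ∸ i
  descending i i<y =
    trans (cycDist-complement complement) (cycDist-short (≤-trans (+-mono-≤ (m∸n≤m (suc y) i) (m∸n≤m (suc y) i)) 2y≤n))
    where
    complement : 2 + (x + i) + (suc y ∸ i) ≡ n
    complement = begin
      2 + (x + i) + (suc y ∸ i)   ≡⟨ +-assoc (2 + x) i _ ⟩
      2 + x + (i + (suc y ∸ i))   ≡⟨ cong (2 + x +_) (m+[n∸m]≡n (≤-trans (<⇒≤ i<y) (n≤1+n y))) ⟩
      2 + x + suc y               ≡⟨ solve 2 (λ x y → con 2 :+ x :+ (con 1 :+ y) := con 1 :+ x :+ (con 1 :+ y) :+ con 1) refl x y ⟩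
      suc x + suc y + 1           ≡⟨ sizes ⟩
      n                           ∎

sort3-elim : ∀ {p} (P : ℕ → ℕ → ℕ → Set p) →
             (∀ {a b c} → P a b c → P b a c) → (∀ {a b c} → P a b c → P a c b) →
             (∀ {x y z} → z ≤ y → y ≤ x → P x y z) → ∀ a b c → P a b c
sort3-elim P swap₁₂ swap₂₃ sorted a b c with ≤-total b a | ≤-total c b | ≤-total c a
... | inj₁ b≤a | inj₁ c≤b | _        = sorted c≤b b≤a
... | inj₁ b≤a | inj₂ b≤c | inj₁ c≤a = swap₂₃ (sorted b≤c c≤a)
... | inj₁ b≤a | inj₂ b≤c | inj₂ a≤c = swap₂₃ (swap₁₂ (sorted b≤a a≤c))
... | inj₂ a≤b | inj₁ c≤b | inj₁ c≤a = swap₁₂ (sorted c≤a a≤b)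
... | inj₂ a≤b | inj₁ c≤b | inj₂ a≤c = swap₁₂ (swap₂₃ (sorted a≤c c≤b))
... | inj₂ a≤b | inj₂ b≤c | _        = swap₁₂ (swap₂₃ (swap₁₂ (sorted a≤b b≤c)))

module _ {n : ℕ} where
  private
    S = TCL n (shellChords n)
    combs : ℕ → ℕ → ℕ → ℕ
    combs a b c = maxCost a + maxCost b + maxCost c

  -- combs a b c is the value of the triangle whose sides are combs with a, b and c leaves.
  IncrementableCombs : ℕ → ℕ → ℕ → Set
  IncrementableCombs a b c = 1 ≤ a → 1 ≤ b → 1 ≤ c → Balanced n a b c → combs a b c < S →
                               BalancedTriple n (suc (combs a b c))

  combTriple-increment-sorted : ∀ {x y z} → z ≤ y → y ≤ x → IncrementableCombs x y z
  -- A side that is an edge of C leaves two combs around a common vertex: the shell graph.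
  combTriple-increment-sorted {z = suc zero} _ _ 1≤x 1≤y _ (sizes , 2x≤n , 2y≤n , _) notMax =
    ⊥-elim (<-irrefl (sym (trans (TCL-shell sizes 2x≤n 2y≤n 1≤x 1≤y) (sym (+-identityʳ _)))) notMax)
  combTriple-increment-sorted {suc x} {y} {suc (suc d)} z≤y y≤x _ _ _ (sizes , 2x≤n , _ , _) _ with m≤n⇒∃[o]m+o≡n z≤y
  ... | k , refl = triple (comb x) (sprout d k) (comb d) balanced value
    where
    balanced : Balanced n (size (comb x)) (size (sprout d k)) (size (comb d))
    balanced rewrite size-comb x | size-sprout d k | size-comb d = sizes′ , 2x≤n , 2y′≤n , 2z′≤n
      where
      open ≤-Reasoning
      sizes′ : suc x + (3 + d + k) + suc d ≡ n
      sizes′ = trans (solve 3 (λ x d k → x :+ (con 3 :+ d :+ k) :+ (con 1 :+ d) := x :+ (con 2 :+ d :+ k) :+ (con 2 :+ d))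
                              refl (suc x) d k) sizes
      2y′≤n : 3 + d + k + (3 + d + k) ≤ n
      2y′≤n = begin
        3 + d + k + (3 + d + k)
          ≡⟨ solve 2 (λ d k → con 3 :+ d :+ k :+ (con 3 :+ d :+ k) := con 2 :+ k :+ (con 2 :+ d :+ k) :+ (con 2 :+ d)) refl d k ⟩
        2 + k + (2 + d + k) + (2 + d)
          ≤⟨ +-monoˡ-≤ (2 + d) (+-monoˡ-≤ (2 + d + k) (≤-trans (s≤s (s≤s (m≤n+m k d))) y≤x)) ⟩
        suc x + (2 + d + k) + (2 + d)
          ≡⟨ sizes ⟩
        n ∎
      2z′≤n : suc d + suc d ≤ n
      2z′≤n = begin
        suc d + suc d                     ≤⟨ +-mono-≤ (n≤1+n (suc d)) (≤-trans (n≤1+n _) (s≤s (s≤s (m≤m+n d k)))) ⟩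
        2 + d + (2 + d + k)               ≡⟨ +-comm (2 + d) _ ⟩
        2 + d + k + (2 + d)               ≤⟨ m≤n+m _ (suc x) ⟩
        suc x + (2 + d + k + (2 + d))     ≡⟨ +-assoc (suc x) _ _ ⟨
        suc x + (2 + d + k) + (2 + d)     ≡⟨ sizes ⟩
        n                                 ∎
    value : linearCost (comb x) + linearCost (sprout d k) + linearCost (comb d) ≡ suc (combs (suc x) (2 + d + k) (2 + d))
    value = begin
      linearCost (comb x) + linearCost (sprout d k) + linearCost (comb d)     ≡⟨ +-assoc (linearCost (comb x)) _ _ ⟩
      linearCost (comb x) + (linearCost (sprout d k) + linearCost (comb d))   ≡⟨ cong₂ _+_ (linearCost-comb x) (moveLeaf d k) ⟩
      maxCost (suc x) + suc (maxCost (2 + d + k) + maxCost (2 + d))           ≡⟨ +-suc (maxCost (suc x)) _ ⟩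
      suc (maxCost (suc x) + (maxCost (2 + d + k) + maxCost (2 + d)))         ≡⟨ cong suc (+-assoc (maxCost (suc x)) _ _) ⟨
      suc (combs (suc x) (2 + d + k) (2 + d))                                 ∎
      where open ≡-Reasoning

  combTriple-increment : ∀ a b c → IncrementableCombs a b c
  combTriple-increment = sort3-elim IncrementableCombs swap₁₂ swap₂₃ combTriple-increment-sorted
    where
    swap₁₂ : ∀ {a b c} → IncrementableCombs a b c → IncrementableCombs b a c
    swap₁₂ {a} {b} {c} inc 1≤b 1≤a 1≤c (sizes , 2b≤n , 2a≤n , 2c≤n) notMax =
      subst (BalancedTriple n ∘ suc) (xy∙z≈yx∙z (maxCost a) (maxCost b) (maxCost c))
        (inc 1≤a 1≤b 1≤c (trans (xy∙z≈yx∙z a b c) sizes , 2a≤n , 2b≤n , 2c≤n)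
             (subst (_< S) (xy∙z≈yx∙z (maxCost b) (maxCost a) (maxCost c)) notMax))
    swap₂₃ : ∀ {a b c} → IncrementableCombs a b c → IncrementableCombs a c b
    swap₂₃ {a} {b} {c} inc 1≤a 1≤c 1≤b (sizes , 2a≤n , 2c≤n , 2b≤n) notMax =
      subst (BalancedTriple n ∘ suc) (xy∙z≈xz∙y (maxCost a) (maxCost b) (maxCost c))
        (inc 1≤a 1≤b 1≤c (trans (xy∙z≈xz∙y a b c) sizes , 2a≤n , 2b≤n , 2c≤n)
             (subst (_< S) (xy∙z≈xz∙y (maxCost a) (maxCost c) (maxCost b)) notMax))

  BalancedTriple-increment : ∀ {v} → v < S → BalancedTriple n v → BalancedTriple n (suc v)
  BalancedTriple-increment v<S (triple A B C balanced value)
    with linearCost A <? maxCost (size A) | linearCost B <? maxCost (size B) | linearCost C <? maxCost (size C)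
  ... | yes A-notMax | _ | _ with linearCost-increment A A-notMax
  ...   | A′ , size≡ , cost≡ = triple A′ B C (subst (λ a → Balanced n a (size B) (size C)) (sym size≡) balanced)
                                 (trans (cong (λ a → a + linearCost B + linearCost C) cost≡) (cong suc value))
  BalancedTriple-increment v<S (triple A B C balanced value) | no _ | yes B-notMax | _ with linearCost-increment B B-notMax
  ...   | B′ , size≡ , cost≡ = triple A B′ C (subst (λ b → Balanced n (size A) b (size C)) (sym size≡) balanced)
                                 (trans (cong (λ b → linearCost A + b + linearCost C) cost≡)
                                        (trans (cong (_+ linearCost C) (+-suc (linearCost A) _)) (cong suc value)))
  BalancedTriple-increment v<S (triple A B C balanced value) | no _ | no _ | yes C-notMax with linearCost-increment C C-notMax
  ...   | C′ , size≡ , cost≡ = triple A B C′ (subst (λ c → Balanced n (size A) (size B) c) (sym size≡) balanced)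
                                 (trans (cong (linearCost A + linearCost B +_) cost≡)
                                        (trans (+-suc (linearCost A + linearCost B) _) (cong suc value)))
  BalancedTriple-increment v<S (triple A B C balanced value) | no A-max | no B-max | no C-max =
    subst (BalancedTriple n ∘ suc) (trans (sym allMax) value)
      (combTriple-increment (size A) (size B) (size C) (1≤size A) (1≤size B) (1≤size C) balanced
        (subst (_< S) (trans (sym value) allMax) v<S))
    where
    allMax : linearCost A + linearCost B + linearCost C ≡ combs (size A) (size B) (size C)
    allMax = cong₂ _+_ (cong₂ _+_ (linearCost-maximal A A-max) (linearCost-maximal B B-max)) (linearCost-maximal C C-max)

  BalancedTriple-upTo : ∀ {v l} → v ≤ l → l ≤ S → BalancedTriple n v → BalancedTriple n l
  BalancedTriple-upTo v≤l l≤S with m≤n⇒∃[o]m+o≡n v≤l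
  ... | k , refl = go k l≤S
    where
    go : ∀ k {v} → v + k ≤ S → BalancedTriple n v → BalancedTriple n (v + k)
    go zero    {v} _       t = subst (BalancedTriple n) (sym (+-identityʳ v)) t
    go (suc k) {v} v+k+1≤S t = subst (BalancedTriple n) (sym (+-suc v k))
      (go k v+1+k≤S (BalancedTriple-increment (≤-trans (s≤s (m≤m+n v k)) v+1+k≤S) t))
      where v+1+k≤S = ≤-trans (≤-reflexive (sym (+-suc v k))) v+k+1≤S

normChord-< : ∀ {x y} → x < y → normChord x y ≡ (x , y)
normChord-< {x} {y} x<y with x <ᵇ y | <ᵇ-reflects-< x y
... | true  | _       = refl
... | false | ofⁿ x≮y = contradiction x<y x≮y

normChord-≥ : ∀ {x y} → y ≤ x → normChord x y ≡ (y , x)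
normChord-≥ {x} {y} y≤x with x <ᵇ y | <ᵇ-reflects-< x y
... | true  | ofʸ x<y = contradiction y≤x (<⇒≱ x<y)
... | false | _       = refl

normChord-comm : ∀ x y → normChord x y ≡ normChord y x
normChord-comm x y with <-cmp x y
... | tri< x<y _ _    = trans (normChord-< x<y) (sym (normChord-≥ (<⇒≤ x<y)))
... | tri≈ _ refl _   = refl
... | tri> _ _ y<x    = trans (normChord-≥ (<⇒≤ y<x)) (sym (normChord-< y<x))

Conflict : Chord → Chord → Set
Conflict c d = c ≡ d ⊎ Cross c d

Conflict-sym : ∀ {c d} → Conflict c d → Conflict d c
Conflict-sym = Sum.map sym Cross-sym

Blocked : List Chord → Chord → Set
Blocked cs c = Any (Conflict c) cs

private
  <³⇒T : ∀ {a b c d e f} → a < b → c < d → e < f → T ((a <ᵇ b) ∧ (c <ᵇ d) ∧ (e <ᵇ f))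
  <³⇒T p q r = Equivalence.from T-∧ (<⇒<ᵇ p , Equivalence.from T-∧ (<⇒<ᵇ q , <⇒<ᵇ r))

  T⇒<³ : ∀ a b c d e f → T ((a <ᵇ b) ∧ (c <ᵇ d) ∧ (e <ᵇ f)) → a < b × c < d × e < f
  T⇒<³ a b c d e f t with Equivalence.to T-∧ t
  ... | p , qr with Equivalence.to (T-∧ {c <ᵇ d}) qr
  ...   | q , r = <ᵇ⇒< a b p , <ᵇ⇒< c d q , <ᵇ⇒< e f r

  ¬T⇒≡false : ∀ {b} → ¬ T b → b ≡ false
  ¬T⇒≡false {false} _  = refl
  ¬T⇒≡false {true}  ¬t = contradiction _ ¬t

Cross⇒crossᵇ : ∀ {c d} → Cross c d → T (crossᵇ c d)
Cross⇒crossᵇ (inj₁ (p , q , r)) = Equivalence.from T-∨ (inj₁ (<³⇒T p q r))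
Cross⇒crossᵇ {a , b} {c , d} (inj₂ (p , q , r)) =
  Equivalence.from (T-∨ {(a <ᵇ c) ∧ (c <ᵇ b) ∧ (b <ᵇ d)}) (inj₂ (<³⇒T p q r))

crossᵇ⇒Cross : ∀ {c d} → T (crossᵇ c d) → Cross c d
crossᵇ⇒Cross {a , b} {c , d} t =
  Sum.map (T⇒<³ a c c b b d) (T⇒<³ c a a d d b) (Equivalence.to (T-∨ {(a <ᵇ c) ∧ (c <ᵇ b) ∧ (b <ᵇ d)}) t)

≡⇒eqChordᵇ : ∀ {c d} → c ≡ d → T (eqChordᵇ c d)
≡⇒eqChordᵇ {a , b} refl = Equivalence.from T-∧ (≡⇒≡ᵇ a a refl , ≡⇒≡ᵇ b b refl)

eqChordᵇ⇒≡ : ∀ {c d} → T (eqChordᵇ c d) → c ≡ d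
eqChordᵇ⇒≡ {a , b} {c , d} t with Equivalence.to T-∧ t
... | p , q = cong₂ _,_ (≡ᵇ⇒≡ a c p) (≡ᵇ⇒≡ b d q)

addableᵇ-blocked : ∀ {cs c} → Blocked cs c → addableᵇ cs c ≡ false
addableᵇ-blocked {cs} {c} blocked with Any-⊎⁻ blocked
... | inj₁ c∈ rewrite Equivalence.to T-≡ (any⁺ (eqChordᵇ c) (Any.map ≡⇒eqChordᵇ c∈)) = refl
... | inj₂ crosses rewrite Equivalence.to T-≡ (any⁺ (crossᵇ c) (Any.map Cross⇒crossᵇ crosses)) = ∧-zeroʳ _

addableᵇ-free : ∀ {cs c} → All (¬_ ∘ Conflict c) cs → addableᵇ cs c ≡ true
addableᵇ-free {cs} {c} free
  rewrite ¬T⇒≡false (All¬⇒¬Any (All.map (λ ¬conflict → ¬conflict ∘ inj₁ ∘ eqChordᵇ⇒≡) free)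
                       ∘ any⁻ (eqChordᵇ c) cs)
        | ¬T⇒≡false (All¬⇒¬Any (All.map (λ ¬conflict → ¬conflict ∘ inj₂ ∘ crossᵇ⇒Cross) free)
                       ∘ any⁻ (crossᵇ c) cs) = refl

-- Chords are named by the offsets of their ends from a base vertex s.  Moving s by one vertex
-- preserves equality, crossing and length of proper chords, so these reduce to the case s = 0.
module Rotation (m : ℕ) where
  n : ℕ
  n = suc m

  vertex : ℕ → ℕ → ℕ
  vertex s x = (s + x) % n

  chord : ℕ → ℕ → ℕ → Chord
  chord s x y = normChord (vertex s x) (vertex s y)

  next : ℕ → ℕ
  next x = suc x % n

  rotate : Chord → Chord
  rotate (p , q) = normChord (next p) (next q)

  Proper : Chord → Set
  Proper (p , q) = p < q × q < n

  suc-% : ∀ a → suc a % n ≡ next (a % n)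
  suc-% a = trans (%-distribˡ-+ 1 a n) (sym (trans (%-distribˡ-+ 1 (a % n) n) (cong (λ r → (1 % n + r) % n) (m%n%n≡m%n a n))))

  chord-suc : ∀ s x y → chord (suc s) x y ≡ rotate (chord s x y)
  chord-suc s x y with vertex s x <ᵇ vertex s y
  ... | true  = cong₂ normChord (suc-% (s + x)) (suc-% (s + y))
  ... | false = trans (cong₂ normChord (suc-% (s + x)) (suc-% (s + y))) (normChord-comm _ _)

  chord-zero : ∀ {x y} → Proper (x , y) → chord 0 x y ≡ (x , y)
  chord-zero (x<y , y<n) = trans (cong₂ normChord (m<n⇒m%n≡m (<-trans x<y y<n)) (m<n⇒m%n≡m y<n)) (normChord-< x<y)

  rotate-inner : ∀ {p q} → p < q → suc q < n → rotate (p , q) ≡ (suc p , suc q)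
  rotate-inner p<q q+1<n = trans (cong₂ normChord (m<n⇒m%n≡m (<-trans (s<s p<q) q+1<n)) (m<n⇒m%n≡m q+1<n)) (normChord-< (s<s p<q))

  rotate-last : ∀ {p} → p < m → rotate (p , m) ≡ (0 , suc p)
  rotate-last p<m = trans (cong₂ normChord (m<n⇒m%n≡m (s<s p<m)) (n%n≡0 n)) (normChord-≥ z≤n)

  data Position : Chord → Set where
    inner : ∀ {p q} → p < q → suc q < n → Position (p , q)
    last  : ∀ {p} → p < m → Position (p , m)

  position : ∀ {c} → Proper c → Position c
  position {p , q} (p<q , q<n) with m≤n⇒m<n∨m≡n (≤-pred q<n)
  ... | inj₁ q<m  = inner p<q (s<s q<m)
  ... | inj₂ refl = last p<q

  rotate-proper : ∀ {c} → Proper c → Proper (rotate c)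
  rotate-proper c-proper with position c-proper
  ... | inner p<q q+1<n rewrite rotate-inner p<q q+1<n = s<s p<q , q+1<n
  ... | last p<m        rewrite rotate-last p<m        = z<s , s<s p<m

  private
    Conflict-suc : ∀ {a b c d} → Conflict (suc a , suc b) (suc c , suc d) ⇔ Conflict (a , b) (c , d)
    Conflict-suc = mk⇔ (Sum.map (λ { refl → refl }) (Sum.map pred³ pred³)) (Sum.map (λ { refl → refl }) (Sum.map suc³ suc³))
      where
      pred³ : ∀ {a b c d e f} → suc a < suc b × suc c < suc d × suc e < suc f → a < b × c < d × e < f
      pred³ (p , q , r) = s<s⁻¹ p , s<s⁻¹ q , s<s⁻¹ r
      suc³ : ∀ {a b c d e f} → a < b × c < d × e < f → suc a < suc b × suc c < suc d × suc e < suc f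
      suc³ (p , q , r) = s<s p , s<s q , s<s r

    Conflict-wrap : ∀ {p q r} → p < q → q < m → Conflict (suc p , suc q) (0 , suc r) ⇔ Conflict (p , q) (r , m)
    Conflict-wrap {p} {q} {r} p<q q<m = mk⇔ to from
      where
      to : Conflict (suc p , suc q) (0 , suc r) → Conflict (p , q) (r , m)
      to (inj₂ (inj₂ (_ , p+1<r+1 , r+1<q+1))) = inj₂ (inj₁ (s<s⁻¹ p+1<r+1 , s<s⁻¹ r+1<q+1 , q<m))
      from : Conflict (p , q) (r , m) → Conflict (suc p , suc q) (0 , suc r)
      from (inj₁ refl)                   = contradiction q<m (<-irrefl refl)
      from (inj₂ (inj₁ (p<r , r<q , _))) = inj₂ (inj₂ (z<s , s<s p<r , s<s r<q))
      from (inj₂ (inj₂ (_ , _ , m<q)))   = contradiction q<m (<-asym m<q)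

    Conflict-last : ∀ {p r} → Conflict (0 , suc p) (0 , suc r) ⇔ Conflict (p , m) (r , m)
    Conflict-last = mk⇔ (λ { (inj₁ refl) → inj₁ refl ; (inj₂ (inj₁ (() , _))) ; (inj₂ (inj₂ (() , _))) })
                        (λ { (inj₁ refl) → inj₁ refl ; (inj₂ (inj₁ (_ , _ , m<m))) → contradiction m<m (<-irrefl refl)
                                                    ; (inj₂ (inj₂ (_ , _ , m<m))) → contradiction m<m (<-irrefl refl) })

    Conflict-sym⇔ : ∀ {c d c′ d′} → Conflict c d ⇔ Conflict c′ d′ → Conflict d c ⇔ Conflict d′ c′
    Conflict-sym⇔ c⇔c′ = mk⇔ (Conflict-sym ∘ Equivalence.to c⇔c′ ∘ Conflict-sym)
                             (Conflict-sym ∘ Equivalence.from c⇔c′ ∘ Conflict-sym)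

  rotate-conflict : ∀ {c d} → Proper c → Proper d → Conflict (rotate c) (rotate d) ⇔ Conflict c d
  rotate-conflict c-proper d-proper with position c-proper | position d-proper
  ... | inner p<q q+1<n | inner r<s s+1<n rewrite rotate-inner p<q q+1<n | rotate-inner r<s s+1<n =
    Conflict-suc
  ... | inner p<q q+1<n | last r<m        rewrite rotate-inner p<q q+1<n | rotate-last r<m =
    Conflict-wrap p<q (s<s⁻¹ q+1<n)
  ... | last p<m        | inner r<s s+1<n rewrite rotate-last p<m | rotate-inner r<s s+1<n =
    Conflict-sym⇔ (Conflict-wrap r<s (s<s⁻¹ s+1<n))
  ... | last p<m        | last r<m        rewrite rotate-last p<m | rotate-last r<m =
    Conflict-last

  chord-proper : ∀ s {x y} → Proper (x , y) → Proper (chord s x y)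
  chord-proper zero    xy-proper rewrite chord-zero xy-proper = xy-proper
  chord-proper (suc s) {x} {y} xy-proper rewrite chord-suc s x y = rotate-proper (chord-proper s xy-proper)

  chord-conflict : ∀ s {a b c d} → Proper (a , b) → Proper (c , d) →
                   Conflict (chord s a b) (chord s c d) ⇔ Conflict (a , b) (c , d)
  chord-conflict zero    ab cd rewrite chord-zero ab | chord-zero cd = mk⇔ id id
  chord-conflict (suc s) {a} {b} {c} {d} ab cd rewrite chord-suc s a b | chord-suc s c d =
    chord-conflict s ab cd ⇔-∘ rotate-conflict (chord-proper s ab) (chord-proper s cd)

  rotate-chordLength : ∀ {c} → Proper c → chordLength n (rotate c) ≡ chordLength n c
  rotate-chordLength c-proper with position c-proper
  ... | inner p<q q+1<n rewrite rotate-inner p<q q+1<n = refl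
  ... | last {p} p<m    rewrite rotate-last p<m        = begin
    suc p ⊓ (m ∸ p)           ≡⟨ ⊓-comm (suc p) _ ⟩
    (m ∸ p) ⊓ suc p           ≡⟨ cong (λ x → (m ∸ p) ⊓ suc x) (m∸[m∸n]≡n (<⇒≤ p<m)) ⟨
    (m ∸ p) ⊓ suc (m ∸ (m ∸ p)) ≡⟨ cong ((m ∸ p) ⊓_) (+-∸-assoc 1 (m∸n≤m m p)) ⟨
    (m ∸ p) ⊓ (n ∸ (m ∸ p))   ∎
    where open ≡-Reasoning

  chord-chordLength : ∀ s {x y} → Proper (x , y) → chordLength n (chord s x y) ≡ chordLength n (x , y)
  chord-chordLength zero    xy-proper = cong (chordLength n) (chord-zero xy-proper)
  chord-chordLength (suc s) {x} {y} xy-proper =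
    trans (cong (chordLength n) (chord-suc s x y)) (trans (rotate-chordLength (chord-proper s xy-proper)) (chord-chordLength s xy-proper))

  vertex<n : ∀ s x → vertex s x < n
  vertex<n s x = m%n<n (s + x) n

  vertex-0 : ∀ {s} → s < n → vertex s 0 ≡ s
  vertex-0 {s} s<n = trans (cong (_% n) (+-identityʳ s)) (m<n⇒m%n≡m s<n)

  vertex-+n : ∀ s x → vertex s (n + x) ≡ vertex s x
  vertex-+n s x = trans (cong (_% n) (trans (sym (+-assoc s n x)) (trans (cong (_+ x) (+-comm s n)) (+-assoc n s x))))
                        (trans (cong (_% n) (+-comm n (s + x))) ([m+n]%n≡m%n (s + x) n))

  vertex-shift : ∀ s a x → vertex (vertex s a) x ≡ vertex s (a + x)
  vertex-shift s a x = begin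
    ((s + a) % n + x) % n            ≡⟨ %-distribˡ-+ ((s + a) % n) x n ⟩
    ((s + a) % n % n + x % n) % n    ≡⟨ cong (λ r → (r + x % n) % n) (m%n%n≡m%n (s + a) n) ⟩
    ((s + a) % n + x % n) % n        ≡⟨ %-distribˡ-+ (s + a) x n ⟨
    (s + a + x) % n                  ≡⟨ cong (_% n) (+-assoc s a x) ⟩
    (s + (a + x)) % n                ∎
    where open ≡-Reasoning

  chord-shift : ∀ s a x y → chord (vertex s a) x y ≡ chord s (a + x) (a + y)
  chord-shift s a x y = cong₂ normChord (vertex-shift s a x) (vertex-shift s a y)

  chord-+n : ∀ s x y → chord s (n + x) (n + y) ≡ chord s x y
  chord-+n s x y = cong₂ normChord (vertex-+n s x) (vertex-+n s y)

  chord-wrap : ∀ s x → chord s x n ≡ chord s 0 x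
  chord-wrap s x = trans (cong (normChord (vertex s x)) (trans ([m+n]%n≡m%n s n) (cong (_% n) (sym (+-identityʳ s)))))
                         (normChord-comm _ _)

  clockwise-vertex : ∀ {s d} → s < n → d < n → clockwise n s d ≡ vertex s d
  clockwise-vertex {s} {d} s<n d<n with (s + d) <ᵇ n | <ᵇ-reflects-< (s + d) n
  ... | true  | ofʸ s+d<n = sym (m<n⇒m%n≡m s+d<n)
  ... | false | ofⁿ s+d≮n = begin
    s + d ∸ n         ≡⟨ m<n⇒m%n≡m (m<n+o⇒m∸n<o (s + d) n (+-mono-< s<n d<n)) ⟨
    (s + d ∸ n) % n   ≡⟨ m≤n⇒[n∸m]%m≡n%m (≮⇒≥ s+d≮n) ⟩
    (s + d) % n       ∎
    where open ≡-Reasoning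

  candidate-chord : ∀ {s d} → s < n → d < n → normChord s (clockwise n s d) ≡ chord s 0 d
  candidate-chord s<n d<n = cong₂ normChord (sym (vertex-0 s<n)) (clockwise-vertex s<n d<n)

private
  Choice = Maybe (Chord × ℕ)

  ≮⇒<ᵇ≡false : ∀ {m n} → ¬ m < n → (m <ᵇ n) ≡ false
  ≮⇒<ᵇ≡false {m} {n} m≮n with m <ᵇ n | <ᵇ-reflects-< m n
  ... | false | _       = refl
  ... | true  | ofʸ m<n = contradiction m<n m≮n

-- The step function of bestChord is local to its where block; unification recovers it.
bestChord-as-foldl : ∀ n cs s → Σ (Choice → ℕ → Choice) λ step →
                       bestChord n cs s ≡ foldl step nothing (applyUpTo (2 +_) (n ∸ 3))
bestChord-as-foldl n cs s = _ , refl

foldl-applyUpTo-keep : ∀ {A : Set} {f : Maybe A → ℕ → Maybe A} {r} k h →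
                       (∀ i → i < k → f (just r) (h i) ≡ just r) → foldl f (just r) (applyUpTo h k) ≡ just r
foldl-applyUpTo-keep zero    h keep = refl
foldl-applyUpTo-keep (suc k) h keep rewrite keep 0 z<s = foldl-applyUpTo-keep k (h ∘ suc) (λ i i<k → keep (suc i) (s<s i<k))

foldl-applyUpTo-select : ∀ {A : Set} {f : Maybe A → ℕ → Maybe A} {r} k h p → p < k →
                         (∀ i → i < p → f nothing (h i) ≡ nothing) → f nothing (h p) ≡ just r →
                         (∀ i → p < i → i < k → f (just r) (h i) ≡ just r) → foldl f nothing (applyUpTo h k) ≡ just r
foldl-applyUpTo-select (suc k) h zero    _         _    chosen keep rewrite chosen =
  foldl-applyUpTo-keep k (h ∘ suc) (λ i i<k → keep (suc i) z<s (s<s i<k))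
foldl-applyUpTo-select (suc k) h (suc p) (s<s p<k) skip chosen keep rewrite skip 0 z<s =
  foldl-applyUpTo-select k (h ∘ suc) p p<k (λ i i<p → skip (suc i) (s<s i<p)) chosen
                         (λ i p<i i<k → keep (suc i) (s<s p<i) (s<s i<k))

module _ (n : ℕ) (cs : List Chord) (s : ℕ) where
  private
    step = proj₁ (bestChord-as-foldl n cs s)
    candidate : ℕ → Chord
    candidate d = normChord s (clockwise n s d)

  step-blocked : ∀ acc d → addableᵇ cs (candidate d) ≡ false → step acc d ≡ acc
  step-blocked acc d blocked rewrite blocked = refl

  step-first : ∀ d → addableᵇ cs (candidate d) ≡ true → step nothing d ≡ just (candidate d , clockwise n s d)
  step-first d free rewrite free = refl

  step-keep : ∀ c t d → addableᵇ cs (candidate d) ≡ true → (chordLength n (candidate d) <ᵇ chordLength n c) ≡ false →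
              step (just (c , t)) d ≡ just (c , t)
  step-keep c t d free notShorter rewrite free | notShorter = refl

  bestChord-select : ∀ p → p < n ∸ 3 →
                     (∀ i → i < p → addableᵇ cs (candidate (2 + i)) ≡ false) →
                     addableᵇ cs (candidate (2 + p)) ≡ true →
                     (∀ i → p < i → i < n ∸ 3 → addableᵇ cs (candidate (2 + i)) ≡ true →
                            chordLength n (candidate (2 + p)) ≤ chordLength n (candidate (2 + i))) →
                     bestChord n cs s ≡ just (candidate (2 + p) , clockwise n s (2 + p))
  bestChord-select p p<k blocked chosen later =
    foldl-applyUpTo-select (n ∸ 3) (2 +_) p p<k (λ i i<p → step-blocked nothing (2 + i) (blocked i i<p))
                           (step-first (2 + p) chosen) (λ i p<i i<k → keep i p<i i<k _ refl)
    where
    keep : ∀ i → p < i → i < n ∸ 3 → ∀ b → addableᵇ cs (candidate (2 + i)) ≡ b →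
           step (just (candidate (2 + p) , clockwise n s (2 + p))) (2 + i) ≡ just (candidate (2 + p) , clockwise n s (2 + p))
    keep i p<i i<k false addable = step-blocked _ (2 + i) addable
    keep i p<i i<k true  addable = step-keep _ _ (2 + i) addable (≮⇒<ᵇ≡false (≤⇒≯ (later i p<i i<k addable)))

-- Predicates on consecutive arcs of g, … sides along C, the first one starting at offset o.
AllArcs : (ℕ → ℕ → Set) → ℕ → List ℕ → Set
AllArcs P o []       = ⊤
AllArcs P o (g ∷ gs) = P o g × AllArcs P (o + g) gs

AnyArc : (ℕ → ℕ → Set) → ℕ → List ℕ → Set
AnyArc P o []       = ⊥
AnyArc P o (g ∷ gs) = P o g ⊎ AnyArc P (o + g) gs

module _ {P : ℕ → ℕ → Set} where
  AllArcs-++⁻ : ∀ o xs ys → AllArcs P o (xs ++ ys) → AllArcs P o xs × AllArcs P (o + sum xs) ys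
  AllArcs-++⁻ o []       ys all = tt , subst (λ o → AllArcs P o ys) (sym (+-identityʳ o)) all
  AllArcs-++⁻ o (x ∷ xs) ys (px , all) with AllArcs-++⁻ (o + x) xs ys all
  ... | allxs , allys = (px , allxs) , subst (λ o → AllArcs P o ys) (+-assoc o x (sum xs)) allys

  AllArcs-++⁺ : ∀ o xs ys → AllArcs P o xs → AllArcs P (o + sum xs) ys → AllArcs P o (xs ++ ys)
  AllArcs-++⁺ o []       ys _           allys = subst (λ o → AllArcs P o ys) (+-identityʳ o) allys
  AllArcs-++⁺ o (x ∷ xs) ys (px , allxs) allys =
    px , AllArcs-++⁺ (o + x) xs ys allxs (subst (λ o → AllArcs P o ys) (sym (+-assoc o x (sum xs))) allys)

  AnyArc-++ˡ : ∀ o xs ys → AnyArc P o xs → AnyArc P o (xs ++ ys)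
  AnyArc-++ˡ o (x ∷ xs) ys (inj₁ px)  = inj₁ px
  AnyArc-++ˡ o (x ∷ xs) ys (inj₂ any) = inj₂ (AnyArc-++ˡ (o + x) xs ys any)

  AnyArc-∷ʳ : ∀ o xs y → P (o + sum xs) y → AnyArc P o (xs ++ y ∷ [])
  AnyArc-∷ʳ o []       y py = inj₁ (subst (λ o → P o y) (+-identityʳ o) py)
  AnyArc-∷ʳ o (x ∷ xs) y py = inj₂ (AnyArc-∷ʳ (o + x) xs y (subst (λ o → P o y) (sym (+-assoc o x (sum xs))) py))

module _ {P Q : ℕ → ℕ → Set} (k : ℕ) (P⇒Q : ∀ o g → P (k + o) g → Q o g) where
  AllArcs-shift : ∀ o xs → AllArcs P (k + o) xs → AllArcs Q o xs
  AllArcs-shift o []       _          = tt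
  AllArcs-shift o (x ∷ xs) (px , all) = P⇒Q o x px , AllArcs-shift (o + x) xs (subst (λ o → AllArcs P o xs) (+-assoc k o x) all)

  AnyArc-shift : ∀ o xs → AnyArc P (k + o) xs → AnyArc Q o xs
  AnyArc-shift o (x ∷ xs) (inj₁ px)  = inj₁ (P⇒Q o x px)
  AnyArc-shift o (x ∷ xs) (inj₂ any) = inj₂ (AnyArc-shift (o + x) xs (subst (λ o → AnyArc P o xs) (+-assoc k o x) any))

FirstPairBounds : List ℕ → Set
FirstPairBounds (a ∷ b ∷ rest) = All (_≤ a + b) rest
FirstPairBounds _              = ⊤

FirstPairBounds-∷ʳ : ∀ {a b} xs → 2 ≤ length xs → All (a ≤_) xs → All (b ≤_) xs → All (_≤ a + b) xs →
                     FirstPairBounds (xs ++ a + b ∷ [])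
FirstPairBounds-∷ʳ (x ∷ [])     (s≤s ()) _ _ _
FirstPairBounds-∷ʳ (x ∷ y ∷ ys) _ (a≤x ∷ _) (_ ∷ b≤y ∷ _) (_ ∷ _ ∷ ys≤a+b) =
  ++⁺ (All.map (λ z≤a+b → ≤-trans z≤a+b a+b≤x+y) ys≤a+b) (a+b≤x+y ∷ [])
  where a+b≤x+y = +-mono-≤ a≤x b≤y

Balanced-sorted : ∀ {n a b c} → a ≤ b → b ≤ c → c ≤ a + b → a + b + c ≡ n → Balanced n a b c
Balanced-sorted {n} {a} {b} {c} a≤b b≤c c≤a+b sizes = sizes ,
  ≤-trans (+-monoʳ-≤ a a≤b) (≤-trans (m≤m+n (a + b) c) (≤-reflexive sizes)) ,
  ≤-trans (+-monoʳ-≤ b b≤c) (≤-trans (m≤n+m (b + c) a) (≤-reflexive (trans (sym (+-assoc a b c)) sizes))) ,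
  ≤-trans (+-monoˡ-≤ c c≤a+b) (≤-reflexive sizes)

module Greedy (m : ℕ) where
  open Rotation m public

  -- Offsets are measured clockwise from the current vertex s.
  Saturated : ℕ → List Chord → ℕ → ℕ → Set
  Saturated s cs o g = ∀ i j → o ≤ i → 2 + i ≤ j → j ≤ o + g → j ≤ i + (n ∸ 2) → Blocked cs (chord s i j)

  Based : ℕ → List Chord → ℕ → ℕ → Set
  Based s cs o g = 2 ≤ g → chord s o (o + g) ∈ cs

  Spans : ℕ → Chord → ℕ → ℕ → Set
  Spans s e o g = ∃[ i ] ∃[ j ] (o ≤ i × i < j × j ≤ o + g × e ≡ chord s i j)

  -- The state of the greedy construction at vertex s: the chords cs cut the polygon into arcs of
  -- gs sides, triangulated inside and closed off by their base chords.
  record Invariant (s : ℕ) (gs : List ℕ) (cs : List Chord) : Set where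
    field
      s<n       : s < n
      arcs-sum  : sum gs ≡ n
      arcs-pos  : All (1 ≤_) gs
      sorted    : AllPairs _≤_ gs
      bounded   : FirstPairBounds gs
      saturated : AllArcs (Saturated s cs) 0 gs
      based     : AllArcs (Based s cs) 0 gs
      covered   : All (λ e → AnyArc (Spans s e) 0 gs) cs

  blocked-by-crossing : ∀ {s cs a b c d} → Proper (a , b) → Proper (c , d) → Cross (a , b) (c , d) →
                        chord s c d ∈ cs → Blocked cs (chord s a b)
  blocked-by-crossing {s} ab cd cross cd∈ =
    Any.map (λ { refl → Equivalence.from (chord-conflict s ab cd) (inj₂ cross) }) cd∈

  Spans-bounds : ∀ {s e} o xs → AnyArc (Spans s e) o xs → Spans s e o (sum xs)
  Spans-bounds o (x ∷ xs) (inj₁ (i , j , o≤i , i<j , j≤o+x , e≡)) =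
    i , j , o≤i , i<j , ≤-trans j≤o+x (+-monoʳ-≤ o (m≤m+n x _)) , e≡
  Spans-bounds {s} {e} o (x ∷ xs) (inj₂ any) with Spans-bounds {s} {e} (o + x) xs any
  ... | i , j , o+x≤i , i<j , j≤ , e≡ =
    i , j , ≤-trans (m≤m+n o x) o+x≤i , i<j , ≤-trans j≤ (≤-reflexive (+-assoc o x _)) , e≡

  Spans-strict : ∀ {s e} o xs → All (1 ≤_) xs → 2 ≤ length xs → AnyArc (Spans s e) o xs →
                 ∃[ i ] ∃[ j ] (o ≤ i × i < j × j ≤ o + sum xs × (i , j) ≢ (o , o + sum xs) × e ≡ chord s i j)
  Spans-strict o (x ∷ [])     _ (s≤s ())
  Spans-strict o (x ∷ y ∷ ys) (_ ∷ 1≤y ∷ _) _ (inj₁ (i , j , o≤i , i<j , j≤o+x , e≡)) =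
    i , j , o≤i , i<j , ≤-trans j≤o+x (+-monoʳ-≤ o (m≤m+n x _)) ,
    (λ { refl → <⇒≱ (+-monoʳ-< o (m<m+n x (≤-trans 1≤y (m≤m+n y (sum ys))))) j≤o+x }) , e≡
  Spans-strict {s} {e} o (x ∷ y ∷ ys) (1≤x ∷ _) _ (inj₂ any) with Spans-bounds {s} {e} (o + x) (y ∷ ys) any
  ... | i , j , o+x≤i , i<j , j≤ , e≡ =
    i , j , ≤-trans (m≤m+n o x) o+x≤i , i<j , ≤-trans j≤ (≤-reflexive (+-assoc o x _)) ,
    (λ { refl → <⇒≱ (m<m+n o 1≤x) o+x≤i }) , e≡

  -- One greedy step: the chord chosen from s closes off the first two arcs, which become one arc
  -- of d = g₁ + g₂ sides at the end of the list; gx and gy are the last two arcs.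
  module Step {s g₁ g₂ : ℕ} {cs : List Chord} (mid : List ℕ) (gx gy : ℕ)
              (inv : Invariant s (g₁ ∷ g₂ ∷ mid ++ gx ∷ gy ∷ []) cs) where
    open Invariant inv

    rs = mid ++ gx ∷ gy ∷ []
    d  = g₁ + g₂
    ox = d + sum mid
    oy = ox + gx

    ox+gx+gy≡n : ox + (gx + gy) ≡ n
    ox+gx+gy≡n = begin
      d + sum mid + (gx + gy)               ≡⟨ +-assoc d (sum mid) _ ⟩
      d + (sum mid + (gx + gy))             ≡⟨ cong (λ x → d + (sum mid + x)) (cong (gx +_) (sym (+-identityʳ gy))) ⟩
      d + (sum mid + sum (gx ∷ gy ∷ []))    ≡⟨ cong (d +_) (sum-++ mid (gx ∷ gy ∷ [])) ⟨
      d + sum rs                            ≡⟨ +-assoc g₁ g₂ _ ⟩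
      sum (g₁ ∷ g₂ ∷ rs)                    ≡⟨ arcs-sum ⟩
      n                                     ∎
      where open ≡-Reasoning

    gx∈rs : gx ∈ rs
    gx∈rs = ∈-++⁺ʳ mid (here refl)
    gy∈rs : gy ∈ rs
    gy∈rs = ∈-++⁺ʳ mid (there (here refl))

    1≤g₁ : 1 ≤ g₁
    1≤g₁ = All.head arcs-pos
    1≤g₂ : 1 ≤ g₂
    1≤g₂ = All.head (All.tail arcs-pos)
    rs-pos : All (1 ≤_) rs
    rs-pos = All.tail (All.tail arcs-pos)

    g₁≤rs : All (g₁ ≤_) rs
    g₂≤rs : All (g₂ ≤_) rs
    rs-sorted : AllPairs _≤_ rs
    g₁≤rs with sorted
    ... | (_ ∷ g₁≤rs) ∷ _ = g₁≤rs
    g₂≤rs with sorted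
    ... | _ ∷ g₂≤rs ∷ _ = g₂≤rs
    rs-sorted with sorted
    ... | _ ∷ _ ∷ rs-sorted = rs-sorted

    2≤d : 2 ≤ d
    2≤d = +-mono-≤ 1≤g₁ 1≤g₂
    d≤gx+gy : d ≤ gx + gy
    d≤gx+gy = +-mono-≤ (All.lookup g₁≤rs gx∈rs) (All.lookup g₂≤rs gy∈rs)
    d≤ox : d ≤ ox
    d≤ox = m≤m+n d (sum mid)
    d+d≤n : d + d ≤ n
    d+d≤n = ≤-trans (+-mono-≤ d≤ox d≤gx+gy) (≤-reflexive ox+gx+gy≡n)
    oy+gy≡n : oy + gy ≡ n
    oy+gy≡n = trans (+-assoc ox gx gy) ox+gx+gy≡n
    oy<n : oy < n
    oy<n = <-≤-trans (m<m+n oy (All.lookup rs-pos gy∈rs)) (≤-reflexive oy+gy≡n)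
    d<n : d < n
    d<n = ≤-<-trans (≤-trans d≤ox (m≤m+n ox gx)) oy<n
    ox≤n∸2 : ox ≤ n ∸ 2
    ox≤n∸2 = m+n≤o⇒m≤o∸n ox (≤-trans (+-monoʳ-≤ ox (+-mono-≤ (All.lookup rs-pos gx∈rs) (All.lookup rs-pos gy∈rs)))
                                     (≤-reflexive ox+gx+gy≡n))
    2≤n : 2 ≤ n
    2≤n = ≤-trans 2≤d (<⇒≤ d<n)

    private
      saturated-rs = AllArcs-++⁻ d mid (gx ∷ gy ∷ []) (proj₂ (proj₂ saturated))
      based-rs = AllArcs-++⁻ d mid (gx ∷ gy ∷ []) (proj₂ (proj₂ based))

    saturated₁ : Saturated s cs 0 g₁
    saturated₁ = proj₁ saturated
    saturated₂ : Saturated s cs g₁ g₂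
    saturated₂ = proj₁ (proj₂ saturated)
    saturated-y : Saturated s cs oy gy
    saturated-y = proj₁ (proj₂ (proj₂ saturated-rs))
    based₁ : Based s cs 0 g₁
    based₁ = proj₁ based
    based₂ : Based s cs g₁ g₂
    based₂ = proj₁ (proj₂ based)
    based-x : Based s cs ox gx
    based-x = proj₁ (proj₂ based-rs)

    blocked-below : ∀ e → 2 ≤ e → e < d → Blocked cs (chord s 0 e)
    blocked-below e 2≤e e<d with e ≤? g₁
    ... | yes e≤g₁ = saturated₁ 0 e z≤n 2≤e e≤g₁ (≤-trans (<⇒≤ e<d) (≤-trans d≤ox ox≤n∸2))
    ... | no e≰g₁  = blocked-by-crossing {s} (≤-trans (s≤s z≤n) 2≤e , <-trans e<d d<n) (m<m+n g₁ 1≤g₂ , d<n)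
                                         (inj₁ (1≤g₁ , ≰⇒> e≰g₁ , e<d)) (based₂ (2≤gap (≰⇒> e≰g₁) e<d))

    blocked-above : ∀ e → ox < e → e ≤ n ∸ 2 → Blocked cs (chord s 0 e)
    blocked-above e ox<e e≤n∸2 with e <? oy
    ... | yes e<oy = blocked-by-crossing {s} (<-trans 0<ox ox<e , <-trans e<oy oy<n) (m<m+n ox 1≤gx , oy<n)
                                         (inj₁ (0<ox , ox<e , e<oy)) (based-x (2≤gap ox<e e<oy))
      where
      1≤gx = All.lookup rs-pos gx∈rs
      0<ox = ≤-trans (s≤s z≤n) (≤-trans 2≤d d≤ox)
    ... | no e≮oy  = subst (Blocked cs) (chord-wrap s e)
                       (saturated-y e n (≮⇒≥ e≮oy) 2+e≤n (≤-reflexive (sym oy+gy≡n)) n≤e+[n∸2])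
      where
      2+e≤n : 2 + e ≤ n
      2+e≤n = ≤-trans (≤-reflexive (+-comm 2 e)) (≤-trans (+-monoˡ-≤ 2 e≤n∸2) (≤-reflexive (m∸n+n≡m 2≤n)))
      n≤e+[n∸2] : n ≤ e + (n ∸ 2)
      n≤e+[n∸2] = ≤-trans (≤-reflexive (sym (m+[n∸m]≡n 2≤n)))
                          (+-monoˡ-≤ (n ∸ 2) (≤-trans 2≤d (≤-trans d≤ox (<⇒≤ ox<e))))

    d+rs≡n : d + sum rs ≡ n
    d+rs≡n = trans (+-assoc g₁ g₂ _) arcs-sum

    proper-d : Proper (0 , d)
    proper-d = ≤-trans (s≤s z≤n) 2≤d , d<n

    ¬Conflict-chord : ∀ {a b a′ b′} → Proper (a , b) → Proper (a′ , b′) →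
                      ¬ Conflict (a , b) (a′ , b′) → ¬ Conflict (chord s a b) (chord s a′ b′)
    ¬Conflict-chord ab ab′ ¬conflict = ¬conflict ∘ Equivalence.to (chord-conflict s ab ab′)

    free : All (¬_ ∘ Conflict (chord s 0 d)) cs
    free = All.map free-in-arc covered
      where
      inside : ∀ {i j} → i < j → j ≤ d → (0 , d) ≢ (i , j) → ¬ Conflict (chord s 0 d) (chord s i j)
      inside i<j j≤d distinct = ¬Conflict-chord proper-d (i<j , ≤-<-trans j≤d d<n)
        λ { (inj₁ eq) → distinct eq ; (inj₂ cross) → ¬Cross-nested z≤n j≤d cross }
      outside : ∀ {i j} → d ≤ i → i < j → j ≤ n → (i , j) ≢ (d , n) → ¬ Conflict (chord s 0 d) (chord s i j)
      outside {i} d≤i i<j j≤n distinct with m≤n⇒m<n∨m≡n j≤n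
      ... | inj₁ j<n  = ¬Conflict-chord proper-d (i<j , j<n)
        λ { (inj₁ refl) → <⇒≱ (proj₁ proper-d) d≤i ; (inj₂ cross) → ¬Cross-disjoint (proj₁ proper-d) d≤i cross }
      ... | inj₂ refl = subst (¬_ ∘ Conflict (chord s 0 d)) (sym (chord-wrap s i))
        (¬Conflict-chord proper-d (<-≤-trans (proj₁ proper-d) d≤i , i<j)
          λ { (inj₁ refl) → distinct refl ; (inj₂ (inj₁ (() , _))) ; (inj₂ (inj₂ (() , _))) })
      free-in-arc : ∀ {e} → AnyArc (Spans s e) 0 (g₁ ∷ g₂ ∷ rs) → ¬ Conflict (chord s 0 d) e
      free-in-arc (inj₁ (i , j , _ , i<j , j≤g₁ , refl)) =
        inside i<j (≤-trans j≤g₁ (m≤m+n g₁ g₂)) λ { refl → <⇒≱ (m<m+n g₁ 1≤g₂) j≤g₁ }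
      free-in-arc (inj₂ (inj₁ (i , j , g₁≤i , i<j , j≤d , refl))) =
        inside i<j j≤d λ { refl → <⇒≱ 1≤g₁ g₁≤i }
      free-in-arc {e} (inj₂ (inj₂ any)) with Spans-strict {s} {e} d rs rs-pos 2≤|rs| any
        where 2≤|rs| = ≤-trans (m≤n+m 2 (length mid)) (≤-reflexive (sym (length-++ mid)))
      ... | i , j , d≤i , i<j , j≤ , distinct , refl =
        outside d≤i i<j (≤-trans j≤ (≤-reflexive d+rs≡n)) (subst (λ k → (i , j) ≢ (d , k)) d+rs≡n distinct)

    length-chord-0 : ∀ {e} → 0 < e → e < n → chordLength n (chord s 0 e) ≡ cycDist n e
    length-chord-0 0<e e<n = chord-chordLength s (0<e , e<n)

    length-first : chordLength n (chord s 0 d) ≡ d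
    length-first = trans (length-chord-0 (proj₁ proper-d) d<n) (cycDist-short d+d≤n)

    private
      p = d ∸ 2
      2+p≡d : 2 + p ≡ d
      2+p≡d = m+[n∸m]≡n 2≤d
      d+2≤n : d + 2 ≤ n
      d+2≤n = ≤-trans (+-monoˡ-≤ 2 (≤-trans d≤ox ox≤n∸2)) (≤-reflexive (m∸n+n≡m 2≤n))
      3≤n : 3 ≤ n
      3≤n = ≤-trans (s≤s (s≤s (s≤s z≤n))) (≤-trans (+-monoˡ-≤ 2 2≤d) d+2≤n)
      candidate : ℕ → Chord
      candidate e = normChord s (clockwise n s e)

    skipped-candidates : ∀ i → i < p → addableᵇ cs (candidate (2 + i)) ≡ false
    skipped-candidates i i<p =
      addableᵇ-blocked (subst (Blocked cs) (sym (candidate-chord s<n (<-trans 2+i<d d<n)))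
                              (blocked-below (2 + i) (s≤s (s≤s z≤n)) 2+i<d))
      where 2+i<d = <-≤-trans (s≤s (s≤s i<p)) (≤-reflexive 2+p≡d)

    chosen-candidate : addableᵇ cs (candidate (2 + p)) ≡ true
    chosen-candidate = subst (λ e → addableᵇ cs (candidate e) ≡ true) (sym 2+p≡d)
                         (subst (λ c → addableᵇ cs c ≡ true) (sym (candidate-chord s<n d<n)) (addableᵇ-free free))

    -- Beyond ox a candidate crosses the base of arc x or lies in arc y; up to ox it is at least
    -- d long both ways round C, since n - ox = gx + gy ≥ d.
    later-candidates : ∀ i → p < i → i < n ∸ 3 → addableᵇ cs (candidate (2 + i)) ≡ true →
                       chordLength n (candidate (2 + p)) ≤ chordLength n (candidate (2 + i))
    later-candidates i p<i i<n∸3 addable with ox <? 2 + i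
    ... | yes ox<e = contradiction (trans (sym addable) blocked) λ ()
      where
      e≤n∸2 : 2 + i ≤ n ∸ 2
      e≤n∸2 = m+n≤o⇒m≤o∸n (2 + i) (≤-trans (≤-reflexive (sym (cong suc (+-suc i 2)))) (m≤o∸n⇒m+n≤o (suc i) 3≤n i<n∸3))
      e<n = ≤-<-trans e≤n∸2 (∸-monoʳ-< {n} {2} {0} z<s 2≤n)
      blocked = addableᵇ-blocked (subst (Blocked cs) (sym (candidate-chord s<n e<n)) (blocked-above (2 + i) ox<e e≤n∸2))
    ... | no ox≮e = begin
      chordLength n (candidate (2 + p))   ≡⟨ cong (chordLength n ∘ candidate) 2+p≡d ⟩
      chordLength n (candidate d)         ≡⟨ cong (chordLength n) (candidate-chord s<n d<n) ⟩
      chordLength n (chord s 0 d)         ≡⟨ length-first ⟩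
      d                                   ≤⟨ ⊓-glb d≤e d≤n∸e ⟩
      cycDist n (2 + i)                   ≡⟨ length-chord-0 z<s e<n ⟨
      chordLength n (chord s 0 (2 + i))   ≡⟨ cong (chordLength n) (candidate-chord s<n e<n) ⟨
      chordLength n (candidate (2 + i))   ∎
      where
      open ≤-Reasoning
      e≤ox = ≮⇒≥ ox≮e
      e<n = ≤-<-trans (≤-trans e≤ox (m≤m+n ox gx)) oy<n
      d≤e : d ≤ 2 + i
      d≤e = ≤-trans (≤-reflexive (sym 2+p≡d)) (s≤s (s≤s (<⇒≤ p<i)))
      d≤n∸e : d ≤ n ∸ (2 + i)
      d≤n∸e = m+n≤o⇒m≤o∸n d (≤-trans (≤-reflexive (+-comm d (2 + i)))
                                    (≤-trans (+-mono-≤ e≤ox d≤gx+gy) (≤-reflexive ox+gx+gy≡n)))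

    bestChord-first : bestChord n cs s ≡ just (chord s 0 d , vertex s d)
    bestChord-first = begin
      bestChord n cs s
        ≡⟨ bestChord-select n cs s p p<n∸3 skipped-candidates chosen-candidate later-candidates ⟩
      just (candidate (2 + p) , clockwise n s (2 + p))
        ≡⟨ cong (λ e → just (candidate e , clockwise n s e)) 2+p≡d ⟩
      just (candidate d , clockwise n s d)
        ≡⟨ cong₂ (λ c t → just (c , t)) (candidate-chord s<n d<n) (clockwise-vertex s<n d<n) ⟩
      just (chord s 0 d , vertex s d) ∎
      where
      open ≡-Reasoning
      p<n∸3 : p < n ∸ 3
      p<n∸3 = m+n≤o⇒m≤o∸n (suc p) (≤-trans (≤-reflexive (trans (cong suc (+-suc p 2)) (cong (_+ 2) 2+p≡d))) d+2≤n)

    s′  = vertex s d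
    cs′ = chord s 0 d ∷ cs
    R   = sum rs

    chord-s′ : ∀ i j → chord s′ i j ≡ chord s (d + i) (d + j)
    chord-s′ = chord-shift s d

    chord-s′-wrapped : ∀ i j → chord s′ (R + i) (R + j) ≡ chord s i j
    chord-s′-wrapped i j = trans (chord-s′ (R + i) (R + j)) (trans (cong₂ (chord s) (wrap i) (wrap j)) (chord-+n s i j))
      where
      wrap : ∀ x → d + (R + x) ≡ n + x
      wrap x = trans (sym (+-assoc d R x)) (cong (_+ x) d+rs≡n)

    Saturated-shift : ∀ o g → Saturated s cs (d + o) g → Saturated s′ cs′ o g
    Saturated-shift o g sat i j o≤i 2+i≤j j≤o+g j≤i+n∸2 =
      there (subst (Blocked cs) (sym (chord-s′ i j))
        (sat (d + i) (d + j) (+-monoʳ-≤ d o≤i) (≤-trans (≤-reflexive (+-suc-suc d i)) (+-monoʳ-≤ d 2+i≤j))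
             (≤-trans (+-monoʳ-≤ d j≤o+g) (≤-reflexive (sym (+-assoc d o g))))
             (≤-trans (+-monoʳ-≤ d j≤i+n∸2) (≤-reflexive (sym (+-assoc d i (n ∸ 2)))))))
      where
      +-suc-suc : ∀ d i → 2 + (d + i) ≡ d + (2 + i)
      +-suc-suc d i = sym (trans (+-suc d (suc i)) (cong suc (+-suc d i)))

    Based-shift : ∀ o g → Based s cs (d + o) g → Based s′ cs′ o g
    Based-shift o g based 2≤g =
      there (subst (_∈ cs) (sym (trans (chord-s′ o (o + g)) (cong (chord s (d + o)) (sym (+-assoc d o g))))) (based 2≤g))

    Spans-shift : ∀ e o g → Spans s e (d + o) g → Spans s′ e o g
    Spans-shift e o g (i , j , d+o≤i , i<j , j≤ , e≡) =
      i ∸ d , j ∸ d ,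
      +-cancelˡ-≤ d o (i ∸ d) (≤-trans d+o≤i (≤-reflexive (sym d+[i∸d]≡i))) ,
      +-cancelˡ-< d (i ∸ d) (j ∸ d) (subst₂ _<_ (sym d+[i∸d]≡i) (sym d+[j∸d]≡j) i<j) ,
      +-cancelˡ-≤ d (j ∸ d) (o + g) (subst₂ _≤_ (sym d+[j∸d]≡j) (+-assoc d o g) j≤) ,
      trans e≡ (trans (cong₂ (chord s) (sym d+[i∸d]≡i) (sym d+[j∸d]≡j)) (sym (chord-s′ (i ∸ d) (j ∸ d))))
      where
      d≤i = ≤-trans (m≤m+n d o) d+o≤i
      d+[i∸d]≡i = m+[n∸m]≡n d≤i
      d+[j∸d]≡j = m+[n∸m]≡n (≤-trans d≤i (<⇒≤ i<j))

    Spans-merge : ∀ e o g → o + g ≤ d → Spans s e o g → Spans s′ e R d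
    Spans-merge e o g o+g≤d (i , j , o≤i , i<j , j≤o+g , e≡) =
      R + i , R + j , m≤m+n R i , +-monoʳ-< R i<j , +-monoʳ-≤ R (≤-trans j≤o+g o+g≤d) ,
      trans e≡ (sym (chord-s′-wrapped i j))

    blocked-merged : ∀ i j → 2 + i ≤ j → j ≤ d → j ≤ i + (n ∸ 2) → Blocked cs′ (chord s i j)
    blocked-merged i j 2+i≤j j≤d j≤i+n∸2 with j ≤? g₁ | g₁ ≤? i
    ... | yes j≤g₁ | _        = there (saturated₁ i j z≤n 2+i≤j j≤g₁ j≤i+n∸2)
    ... | no _     | yes g₁≤i = there (saturated₂ i j g₁≤i 2+i≤j j≤d j≤i+n∸2)
    ... | no j≰g₁  | no g₁≰i  = straddling i (≰⇒> g₁≰i) (≰⇒> j≰g₁)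
      where
      straddling : ∀ i → i < g₁ → g₁ < j → Blocked cs′ (chord s i j)
      straddling (suc i) i<g₁ g₁<j = there (blocked-by-crossing {s}
        (<-trans i<g₁ g₁<j , ≤-<-trans j≤d d<n) (1≤g₁ , <-trans g₁<j (≤-<-trans j≤d d<n))
        (inj₂ (z<s , i<g₁ , g₁<j)) (based₁ (2≤gap (z<s {i}) i<g₁)))
      straddling zero _ g₁<j with j ≟ d
      ... | yes refl = here (inj₁ refl)
      ... | no j≢d   = there (blocked-by-crossing {s}
        (<-trans 1≤g₁ g₁<j , <-trans j<d d<n) (m<m+n g₁ 1≤g₂ , d<n)
        (inj₁ (1≤g₁ , g₁<j , j<d)) (based₂ (2≤gap g₁<j j<d)))
        where j<d = ≤∧≢⇒< j≤d j≢d

    saturated-merged : Saturated s′ cs′ R d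
    saturated-merged i j R≤i 2+i≤j j≤R+d j≤i+n∸2 =
      subst (Blocked cs′) (trans (sym (chord-s′-wrapped i′ j′)) (cong₂ (chord s′) R+i′≡i R+j′≡j))
        (blocked-merged i′ j′ (+-cancelˡ-≤ R (2 + i′) j′ (subst₂ _≤_ (sym R+[2+i′]) (sym R+j′≡j) 2+i≤j))
                               (+-cancelˡ-≤ R j′ d (subst (_≤ R + d) (sym R+j′≡j) j≤R+d))
                               (+-cancelˡ-≤ R j′ (i′ + (n ∸ 2)) (subst₂ _≤_ (sym R+j′≡j) R+[i′+n∸2] j≤i+n∸2)))
      where
      i′ = i ∸ R
      j′ = j ∸ R
      R+i′≡i = m+[n∸m]≡n R≤i
      R+j′≡j = m+[n∸m]≡n (≤-trans R≤i (≤-trans (m≤n+m i 2) 2+i≤j))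
      R+[i′+n∸2] : i + (n ∸ 2) ≡ R + (i′ + (n ∸ 2))
      R+[i′+n∸2] = trans (cong (_+ (n ∸ 2)) (sym R+i′≡i)) (+-assoc R i′ _)
      R+[2+i′] : R + (2 + i′) ≡ 2 + i
      R+[2+i′] = trans (+-suc R (suc i′)) (cong suc (trans (+-suc R i′) (cong suc R+i′≡i)))

    chord-new : chord s 0 d ≡ chord s′ R (R + d)
    chord-new = trans (sym (chord-s′-wrapped 0 d)) (cong (λ r → chord s′ r (R + d)) (+-identityʳ R))

    invariant′ : Invariant s′ (rs ++ d ∷ []) cs′
    invariant′ = record
      { s<n       = vertex<n s d
      ; arcs-sum  = trans (sum-++ rs (d ∷ [])) (trans (cong (R +_) (+-identityʳ d)) (trans (+-comm R d) d+rs≡n))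
      ; arcs-pos  = ++⁺ rs-pos (≤-trans (s≤s z≤n) 2≤d ∷ [])
      ; sorted    = AllPairsₚ.++⁺ rs-sorted ([] ∷ []) (All.map (_∷ []) rs≤d)
      ; bounded   = FirstPairBounds-∷ʳ rs 2≤|rs| g₁≤rs g₂≤rs rs≤d
      ; saturated = AllArcs-++⁺ 0 rs (d ∷ []) (AllArcs-shift d Saturated-shift 0 rs (from-d+0 (proj₂ (proj₂ saturated))))
                                            (saturated-merged , tt)
      ; based     = AllArcs-++⁺ 0 rs (d ∷ []) (AllArcs-shift d Based-shift 0 rs (from-d+0 (proj₂ (proj₂ based))))
                                            ((λ _ → here (sym chord-new)) , tt)
      ; covered   = AnyArc-∷ʳ 0 rs d (R , R + d , ≤-refl , m<m+n R (≤-trans (s≤s z≤n) 2≤d) , ≤-refl , chord-new)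
                    ∷ All.map covered-old covered
      }
      where
      rs≤d : All (_≤ d) rs
      rs≤d = bounded
      2≤|rs| : 2 ≤ length rs
      2≤|rs| = ≤-trans (m≤n+m 2 (length mid)) (≤-reflexive (sym (length-++ mid)))
      from-d+0 : ∀ {P} → AllArcs P d rs → AllArcs P (d + 0) rs
      from-d+0 {P} = subst (λ o → AllArcs P o rs) (sym (+-identityʳ d))
      covered-old : ∀ {e} → AnyArc (Spans s e) 0 (g₁ ∷ g₂ ∷ rs) → AnyArc (Spans s′ e) 0 (rs ++ d ∷ [])
      covered-old {e} (inj₁ spans)         = AnyArc-∷ʳ 0 rs d (Spans-merge e 0 g₁ (m≤m+n g₁ g₂) spans)
      covered-old {e} (inj₂ (inj₁ spans))  = AnyArc-∷ʳ 0 rs d (Spans-merge e g₁ g₂ ≤-refl spans)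
      covered-old {e} (inj₂ (inj₂ any))    =
        AnyArc-++ˡ 0 rs (d ∷ []) (AnyArc-shift d (Spans-shift e) 0 rs
                                   (subst (λ o → AnyArc (Spans s e) o rs) (sym (+-identityʳ d)) any))

  greedyGo-step : ∀ {k s cs c t} → bestChord n cs s ≡ just (c , t) → greedyGo n (suc k) s cs ≡ greedyGo n k t (c ∷ cs)
  greedyGo-step chosen rewrite chosen = refl

  last-two : ∀ (xs : List ℕ) → 2 ≤ length xs → ∃[ mid ] ∃[ x ] ∃[ y ] (xs ≡ mid ++ x ∷ y ∷ [])
  last-two (x ∷ [])         (s≤s ())
  last-two (x ∷ y ∷ [])     _ = [] , x , y , refl
  last-two (x ∷ y ∷ z ∷ xs) _ with last-two (y ∷ z ∷ xs) (s≤s (s≤s z≤n))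
  ... | mid , x′ , y′ , eq = x ∷ mid , x′ , y′ , cong (x ∷_) eq

  greedy-balanced : ∀ k {s} ts {cs} → Invariant s (map size ts) cs → length ts ≡ 3 + k →
                    TCL n cs ≡ sum (map linearCost ts) → BalancedTriple n (TCL n (greedyGo n k s cs))
  greedy-balanced zero (A ∷ B ∷ C ∷ []) inv _ tcl =
    triple A B C balanced (sym (trans tcl (sum₃ (linearCost A) (linearCost B) (linearCost C))))
    where
    open Invariant inv
    sum₃ : ∀ a b c → a + (b + (c + 0)) ≡ a + b + c
    sum₃ a b c = trans (sym (+-assoc a b (c + 0))) (cong (a + b +_) (+-identityʳ c))
    balanced : Balanced n (size A) (size B) (size C)
    balanced with sorted | bounded
    ... | (a≤b ∷ _) ∷ (b≤c ∷ []) ∷ _ | c≤a+b ∷ [] =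
      Balanced-sorted a≤b b≤c c≤a+b (trans (sym (sum₃ (size A) (size B) (size C))) arcs-sum)
  greedy-balanced (suc k) {s} (A ∷ B ∷ rest) {cs} inv len tcl with last-two (map size rest) 2≤|rest|
    where
    2≤|rest| : 2 ≤ length (map size rest)
    2≤|rest| = ≤-trans (s≤s (s≤s z≤n)) (≤-reflexive (sym (trans (length-map size rest) (suc-injective (suc-injective len)))))
  ... | mid , gx , gy , sizes-rest =
    subst (BalancedTriple n ∘ TCL n) (sym (greedyGo-step S.bestChord-first)) (greedy-balanced k merged inv′ len′ tcl′)
    where
    module S = Step mid gx gy (subst (λ rs → Invariant s (size A ∷ size B ∷ rs) cs) sizes-rest inv)
    merged = rest ++ node A B ∷ []
    inv′ : Invariant S.s′ (map size merged) S.cs′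
    inv′ = subst (λ gs → Invariant S.s′ gs S.cs′) (trans (cong (_++ _) (sym sizes-rest)) (sym (map-++ size rest _))) S.invariant′
    len′ : length merged ≡ 3 + k
    len′ = trans (length-++ rest) (trans (+-comm (length rest) 1) (suc-injective len))
    tcl′ : TCL n S.cs′ ≡ sum (map linearCost merged)
    tcl′ = begin
      chordLength n (chord s 0 S.d) + TCL n cs
        ≡⟨ cong₂ _+_ S.length-first tcl ⟩
      size A + size B + (linearCost A + (linearCost B + sum (map linearCost rest)))
        ≡⟨ solve 5 (λ a b x y r → a :+ b :+ (x :+ (y :+ r)) := r :+ (a :+ b :+ x :+ y :+ con 0)) refl
                   (size A) (size B) (linearCost A) (linearCost B) (sum (map linearCost rest)) ⟩
      sum (map linearCost rest) + sum (map linearCost (node A B ∷ []))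
        ≡⟨ sum-++ (map linearCost rest) _ ⟨
      sum (map linearCost rest ++ map linearCost (node A B ∷ []))
        ≡⟨ cong sum (map-++ linearCost rest _) ⟨
      sum (map linearCost merged) ∎
      where open ≡-Reasoning

  private
    ones = replicate n 1

    sum-ones : ∀ k → sum (replicate k 1) ≡ k
    sum-ones zero    = refl
    sum-ones (suc k) = cong suc (sum-ones k)

    ones-sorted : ∀ k → AllPairs _≤_ (replicate k 1)
    ones-sorted zero    = []
    ones-sorted (suc k) = replicate⁺ k ≤-refl ∷ ones-sorted k

    ones-bounded : ∀ k → FirstPairBounds (replicate k 1)
    ones-bounded zero          = tt
    ones-bounded (suc zero)    = tt
    ones-bounded (suc (suc k)) = replicate⁺ k (s≤s z≤n)

    ones-saturated : ∀ k o → AllArcs (Saturated 0 []) o (replicate k 1)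
    ones-saturated zero    o = tt
    ones-saturated (suc k) o = no-chord , ones-saturated k (o + 1)
      where
      no-chord : Saturated 0 [] o 1
      no-chord i j o≤i 2+i≤j j≤o+1 _ =
        ⊥-elim (<-irrefl refl (≤-trans (s≤s (s≤s o≤i)) (≤-trans 2+i≤j (≤-trans j≤o+1 (≤-reflexive (+-comm o 1))))))

    ones-based : ∀ k o → AllArcs (Based 0 []) o (replicate k 1)
    ones-based zero    o = tt
    ones-based (suc k) o = (λ { (s≤s ()) }) , ones-based k (o + 1)

    leaves-linearCost : ∀ k → sum (map linearCost (replicate k leaf)) ≡ 0
    leaves-linearCost zero    = refl
    leaves-linearCost (suc k) = leaves-linearCost k

  initial : Invariant 0 (map size (replicate n leaf)) []
  initial = subst (λ gs → Invariant 0 gs []) (sym (map-replicate size n leaf)) record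
    { s<n = z<s ; arcs-sum = sum-ones n ; arcs-pos = replicate⁺ n ≤-refl ; sorted = ones-sorted n ; bounded = ones-bounded n
    ; saturated = ones-saturated n 0 ; based = ones-based n 0 ; covered = [] }

  greedyChords-balanced : 3 ≤ n → BalancedTriple n (TCL n (greedyChords n))
  greedyChords-balanced 3≤n = greedy-balanced (n ∸ 3) (replicate n leaf) initial
    (trans (length-replicate n) (sym (m+[n∸m]≡n 3≤n))) (sym (leaves-linearCost n))

theorem6 : ∀ (n : ℕ) → 5 ≤ n → ∀ (l : ℕ) →
    TCL n (greedyChords n) ≤ l → l ≤ TCL n (shellChords n) →
    ∃[ cs ] (IsMOP n cs × TCL n cs ≡ l)
theorem6 (suc m) 5≤n l greedy≤l l≤shell =
  BalancedTriple⇒MOP (BalancedTriple-upTo greedy≤l l≤shell (Greedy.greedyChords-balanced m 3≤n))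
  where
  3≤n = ≤-trans (s≤s (s≤s (s≤s z≤n))) 5≤n
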